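{- Let $p$ be a prime with $p \equiv 1 \pmod 8$ and $p \equiv 2 \pmod 3$, and let $n \ge 2$ be an integer. Let $(\alpha,\beta,\kappa) \in \mathbb{Z}^3$ be nonzero integers satisfying: (B1) $\alpha,\beta$ are odd and $\gcd(\alpha,3)=\gcd(\alpha,p)=\gcd(\alpha,\beta)=\gcd(\beta,p)=1$; (B2) for every odd prime $l$ with $\gcd(l,3)=1$ and $l \mid \alpha\beta$, $p$ is a square in $\mathbb{Q}_l^\times$; (B3) $v_3(\kappa) < 2n-1$ and $v_3(\kappa)$ is an odd positive integer; (B4) $\kappa \not\equiv 0 \pmod p$; (B5) for every odd prime $l$ with $\gcd(l,3)=1$ and $l \mid \kappa$, $p$ is a square in $\mathbb{Q}_l^\times$. Define $A = \frac{p\alpha^2 - 9\beta^2}{2}$, $B = 9(p\alpha^2 - 9\beta^2)\kappa^2$, $C = 9(p\alpha^2+9\beta^2)\kappa^2$, $D = \frac{p\alpha^2+9\beta^2}{2}$, $E = 81\alpha\beta\kappa^3$, $F = 18\alpha\beta\kappa$, $G = 3\alpha\beta$. Then $(A,B,C,D,E,F,G)$ satisfies Hypothesis FM with respect to $(p,n)$.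
   Context: For a prime $p \equiv 1 \pmod 8$, $\mathcal{X}_p \subseteq \mathbb{P}^6_{\mathbb{Q}}$ is the threefold with coordinates $(a:b:c:d:e:f:g)$ defined by $b^2 - c^2 + 2pef = 0$, $2ab - 2cd + pf^2 = 0$, $a^2 - d^2 + pg^2 = 0$. For a positive integer $n$, a septuple $(A,B,C,D,E,F,G)\in\mathbb{Z}^7$, not all zero, satisfies Hypothesis FM with respect to $(p,n)$ if: (A1) $(A:B:C:D:E:F:G) \in \mathcal{X}_p(\mathbb{Q})$; (A2) for every odd prime $l$ with $\gcd(l,3)=\gcd(l,p)=1$ and $l \mid E$: $p$ is a square in $\mathbb{Q}_l^\times$ or $v_l(E) - v_l(G) < 6n$; (A3) $\gcd(A,D,G)=1$, $E \not\equiv 0 \pmod p$ and $G \not\equiv 0 \pmod p$; (A4) for every odd prime $l$ with $\gcd(l,3)=\gcd(l,p)=1$ and $l \mid \gcd(AC-BD, DE-CF, AE-BF)$: $p$ is a square in $\mathbb{Q}_l^\times$; (A5) there is an integer $H$ with $G - EH^6 \equiv 0 \pmod p$ such that $A + \zeta B H^4$ is a quadratic non-residue in $\mathbb{F}_p^\times$ for every cube root of unity $\zeta \in \mathbb{F}_p^\times$; and moreover, if $3$ is a quadratic non-residue in $\mathbb{F}_p^\times$: (A6) $v_3(E) - v_3(G) < 6n$; (A7) $A + B \not\equiv 0 \pmod 3$ and $G \equiv 0 \pmod 3$. Here $v_l$ is the $l$-adic valuation. -}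

module Defs where

open import Data.Nat as ℕ using (ℕ; zero; suc)
import Data.Nat.Divisibility as ℕD
import Data.Nat.GCD as ℕG
open import Data.Nat.Primality using (Prime)
open import Data.Integer as ℤ using (ℤ; +_; 0ℤ; 1ℤ; _+_; _-_; _*_; _^_; _/_)
open import Data.Integer.Divisibility using (_∣_)
open import Data.Integer.GCD using (gcd)
open import Data.Product using (Σ; ∃; ∃-syntax; _×_)
open import Data.Sum using (_⊎_)
open import Relation.Nullary using (¬_)
open import Relation.Binary.PropositionalEquality using (_≡_; _≢_)

-- l-adic valuation as a relation: v_l(m) = k  (only holds for m ≠ 0)
Val : ℕ → ℤ → ℕ → Set
Val l m k = ((+ l) ^ k ∣ m) × ¬ ((+ l) ^ (suc k) ∣ m)

-- the integer m is a square in ℚ_l^× (l a prime):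
-- m = l^(2j) u with u an l-adic unit which is a square in ℤ_l, i.e.
-- x² ≡ u (mod l^k) is solvable for every k.
IsSquareQl : ℕ → ℤ → Set
IsSquareQl l m =
  ∃[ j ] ∃[ u ] (m ≡ (+ l) ^ (2 ℕ.* j) * u) × ¬ ((+ l) ∣ u)
    × (∀ (k : ℕ) → ∃[ x ] ((+ l) ^ k ∣ (x * x - u)))

QNR : ℕ → ℤ → Set
QNR p x = ¬ ((+ p) ∣ x) × ¬ (∃[ y ] ((+ p) ∣ (y * y - x)))

CubeRootOfUnity : ℕ → ℤ → Set
CubeRootOfUnity p ζ = (+ p) ∣ (ζ ^ 3 - 1ℤ)

OddPrimeCoprime3 : ℕ → Set
OddPrimeCoprime3 l = Prime l × ¬ (2 ℕD.∣ l) × ℕG.gcd l 3 ≡ 1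

OnXp : ℕ → ℤ → ℤ → ℤ → ℤ → ℤ → ℤ → ℤ → Set
OnXp p a b c d e f g =
  ¬ (a ≡ 0ℤ × b ≡ 0ℤ × c ≡ 0ℤ × d ≡ 0ℤ × e ≡ 0ℤ × f ≡ 0ℤ × g ≡ 0ℤ)
  × (b * b - c * c + (+ 2) * (+ p) * e * f ≡ 0ℤ)
  × ((+ 2) * a * b - (+ 2) * c * d + (+ p) * f * f ≡ 0ℤ)
  × (a * a - d * d + (+ p) * g * g ≡ 0ℤ)

record HypothesisFM (p n : ℕ) (A B C D E F G : ℤ) : Set where
  field
    A1 : OnXp p A B C D E F G
    A2 : ∀ (l : ℕ) → OddPrimeCoprime3 l → ℕG.gcd l p ≡ 1 → (+ l) ∣ E →
           IsSquareQl l (+ p)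
           ⊎ (∃[ e ] ∃[ g ] Val l E e × Val l G g × e ℕ.< g ℕ.+ 6 ℕ.* n)
    A3 : (gcd (gcd A D) G ≡ 1ℤ) × ¬ ((+ p) ∣ E) × ¬ ((+ p) ∣ G)
    A4 : ∀ (l : ℕ) → OddPrimeCoprime3 l → ℕG.gcd l p ≡ 1 →
           (+ l) ∣ (A * C - B * D) → (+ l) ∣ (D * E - C * F) →
           (+ l) ∣ (A * E - B * F) → IsSquareQl l (+ p)
    A5 : ∃[ H ] ((+ p) ∣ (G - E * H ^ 6))
           × (∀ (ζ : ℤ) → CubeRootOfUnity p ζ → QNR p (A + ζ * B * H ^ 4))
    A6 : QNR p (+ 3) →
           ∃[ e ] ∃[ g ] Val 3 E e × Val 3 G g × e ℕ.< g ℕ.+ 6 ℕ.* n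
    A7 : QNR p (+ 3) → ¬ ((+ 3) ∣ (A + B)) × ((+ 3) ∣ G)

Aα : ℕ → ℤ → ℤ → ℤ
Aα p α β = ((+ p) * α * α - (+ 9) * β * β) / (+ 2)

Bα : ℕ → ℤ → ℤ → ℤ → ℤ
Bα p α β κ = (+ 9) * ((+ p) * α * α - (+ 9) * β * β) * κ * κ

Cα : ℕ → ℤ → ℤ → ℤ → ℤ
Cα p α β κ = (+ 9) * ((+ p) * α * α + (+ 9) * β * β) * κ * κ

Dα : ℕ → ℤ → ℤ → ℤ
Dα p α β = ((+ p) * α * α + (+ 9) * β * β) / (+ 2)

Eα : ℤ → ℤ → ℤ → ℤ
Eα α β κ = (+ 81) * α * β * κ * κ * κ

Fα : ℤ → ℤ → ℤ → ℤ
Fα α β κ = (+ 18) * α * β * κ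

Gα : ℤ → ℤ → ℤ
Gα α β = (+ 3) * α * β

-- A1 and A4 are polynomial identities in p, α, β, κ once the halves A and D are
-- cleared of their denominator, and A2, A3, A4, A6, A7 reduce to the hypotheses through the
-- factorisations E = 3⁴αβκ³, G = 3αβ and 2(DE - CF) - 2(AE - BF) = -2·3⁷αβ³κ³.  The substance
-- is A5.  As v₃(κ) is odd, 3κ = 3^(2j) κ′ with 3 ∤ κ′, and κ′ is a square modulo p: -1 and 2 are
-- squares since p ≡ 1 (mod 8), and an odd prime l ∣ κ is a square by quadratic reciprocity, p being
-- a square modulo l.  Taking w² ≡ 3κ and H ≡ w⁻¹ gives 3κH² ≡ 1, whence G ≡ EH⁶.  Since p ≡ 2 (mod 3)
-- makes 3 a non-square, 1 is the only cube root of unity, and 2(A + BH⁴) ≡ -27β² shows that a square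
-- root of A + BH⁴ would be one of 3.  Reciprocity itself comes from Gauss's lemma and Eisenstein's
-- lattice-point count, and Euler's criterion from Wilson's theorem, both by pairing residues.

module Submission where

open import Defs

open import Data.Nat as ℕ using (ℕ; zero; suc; z≤n; s≤s; NonZero)
import Data.Nat.Properties as ℕ
import Data.Nat.Divisibility as ℕ
import Data.Nat.DivMod as ℕ
open import Data.Nat.Primality
  using (Prime; prime?; prime⇒nonTrivial; euclidsLemma; prime⇒nonZero; prime⇒irreducible; ¬prime[0]; ¬prime[1])
open import Data.Nat.Coprimality using (prime⇒coprime; coprime-Bézout) renaming (sym to coprime-sym)
open import Data.Nat.GCD using (module Bézout)
import Data.Nat.GCD as ℕ
open import Data.Integer as ℤ using (ℤ; +_; 0ℤ; 1ℤ; -1ℤ; _+_; _-_; _*_; -_; _^_) renaming (∣_∣ to abs)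
import Data.Integer.Properties as ℤ
import Data.Integer.Divisibility as Unsigned
open import Data.Integer.Divisibility.Signed
  using (_∣_; divides; ∣ᵤ⇒∣; ∣⇒∣ᵤ; _∣?_; ∣-refl; ∣-trans; ∣m∣n⇒∣m+n; ∣m+n∣n⇒∣m; ∣m⇒∣-m; ∣m∣n⇒∣m-n; ∣n⇒∣m*n; ∣m⇒∣m*n)
open import Data.Integer.DivMod using (_%ℕ_; _/ℕ_; n%ℕd<d; a≡a%ℕn+[a/ℕn]*n; a≡a%n+[a/n]*n)
open import Data.Integer.GCD using (gcd; gcd[i,j]∣i; gcd[i,j]∣j; gcd-greatest; gcd[i,j]≡0⇒j≡0)
open import Data.Integer.Tactic.RingSolver using (solve-∀)
open import Data.Nat.Tactic.RingSolver using () renaming (solve-∀ to ℕ-solve-∀)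
open import Data.Nat.ListAction using (sum; product)
open import Data.Nat.ListAction.Properties using (sum-↭; ∈⇒∣product)
open import Data.Nat.Primality.Factorisation using (factorise; module PrimeFactorisation)
open import Algebra.Bundles using (CommutativeMonoid)
open import Data.List using (List; []; _∷_; _++_; _∷ʳ_; length; foldr; foldl; map; applyUpTo)
import Data.List.Properties as List
open import Data.List.Membership.Propositional using (_∈_)
open import Data.List.Membership.Propositional.Properties using (∈-∃++; ∈-applyUpTo⁺; ∈-applyUpTo⁻; ∈-map⁻)
open import Data.List.Relation.Unary.Any using (here; there)
open import Data.List.Relation.Unary.All using (All; []; _∷_)
import Data.List.Relation.Unary.All as All
import Data.List.Relation.Unary.All.Properties as All
import Data.List.Relation.Unary.AllPairs.Properties as AllPairs
open import Data.List.Relation.Unary.AllPairs using (AllPairs; []; _∷_)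
open import Data.List.Relation.Unary.Unique.Propositional using (Unique)
open import Data.List.Relation.Binary.Pointwise using (Pointwise; []; _∷_)
open import Data.List.Relation.Binary.Subset.Propositional using (_⊆_)
open import Data.List.Relation.Binary.Permutation.Propositional using (_↭_; ↭-refl; ↭-sym; ↭-trans; ↭-prep; ↭⇒↭ₛ)
open import Data.List.Relation.Binary.Permutation.Propositional.Properties
  using (shift; ∷↭∷ʳ; ↭-length; ∈-resp-↭; All-resp-↭) renaming (map⁺ to ↭-map⁺)
import Data.List.Relation.Binary.Permutation.Setoid.Properties as Permutationₛ
open Permutationₛ (ℤ.≡-setoid) using (AllPairs-resp-↭)
open import Induction.WellFounded using (Acc; acc)
open import Data.Nat.Induction using (<-wellFounded)
open import Data.Product using (∃-syntax; _×_; _,_; proj₁; proj₂; uncurry)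
open import Data.Sum using (_⊎_; inj₁; inj₂; [_,_]′)
open import Data.Empty using (⊥-elim)
open import Function using (_∘_; case_of_)
open import Relation.Nullary using (¬_; Dec; yes; no)
open import Relation.Nullary.Decidable using (map′; from-yes; from-no)
open import Data.Fin using (toℕ; fromℕ<)
import Data.Fin.Properties as Fin
open import Relation.Binary.Bundles using (Setoid)
open import Relation.Binary.Definitions using (tri<; tri≈; tri>)
open import Relation.Binary.PropositionalEquality

-- Congruences

-- a record, so that a, b and m can be recovered from a proof by unification
infix 4 _≡_mod_
record _≡_mod_ (a b : ℤ) (m : ℕ) : Set where
  constructor congruent
  field m∣a-b : + m ∣ a - b
open _≡_mod_ public

∣-subst : ∀ {k x y} → x ≡ y → k ∣ x → k ∣ y
∣-subst refl k∣x = k∣x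

module _ {m : ℕ} where

  mod-refl : ∀ {a} → a ≡ a mod m
  mod-refl {a} = congruent (divides 0ℤ (trans (ℤ.+-inverseʳ a) (sym (ℤ.*-zeroˡ (+ m)))))

  mod-reflexive : ∀ {a b} → a ≡ b → a ≡ b mod m
  mod-reflexive refl = mod-refl

  mod-sym : ∀ {a b} → a ≡ b mod m → b ≡ a mod m
  mod-sym {a} {b} (congruent d) = congruent (∣-subst (neg-diff a b) (∣m⇒∣-m d))
    where
    neg-diff : ∀ a b → - (a - b) ≡ b - a
    neg-diff = solve-∀

  mod-trans : ∀ {a b c} → a ≡ b mod m → b ≡ c mod m → a ≡ c mod m
  mod-trans {a} {b} {c} (congruent d) (congruent e) = congruent (∣-subst (telescope a b c) (∣m∣n⇒∣m+n d e))
    where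
    telescope : ∀ a b c → (a - b) + (b - c) ≡ a - c
    telescope = solve-∀

  +-cong-mod : ∀ {a b c d} → a ≡ b mod m → c ≡ d mod m → a + c ≡ b + d mod m
  +-cong-mod {a} {b} {c} {d} (congruent x) (congruent y) = congruent (∣-subst (diff-+ a b c d) (∣m∣n⇒∣m+n x y))
    where
    diff-+ : ∀ a b c d → (a - b) + (c - d) ≡ (a + c) - (b + d)
    diff-+ = solve-∀

  *-cong-mod : ∀ {a b c d} → a ≡ b mod m → c ≡ d mod m → a * c ≡ b * d mod m
  *-cong-mod {a} {b} {c} {d} (congruent x) (congruent y) =
    congruent (∣-subst (diff-* a b c d) (∣m∣n⇒∣m+n (∣m⇒∣m*n c x) (∣n⇒∣m*n b y)))
    where
    diff-* : ∀ a b c d → (a - b) * c + b * (c - d) ≡ a * c - b * d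
    diff-* = solve-∀

  -‿cong-mod : ∀ {a b} → a ≡ b mod m → - a ≡ - b mod m
  -‿cong-mod {a} {b} (congruent x) = congruent (∣-subst (sym (diff-neg a b)) (∣m⇒∣-m x))
    where
    diff-neg : ∀ a b → (- a) - (- b) ≡ - (a - b)
    diff-neg = solve-∀

  ^-cong-mod : ∀ {a b} n → a ≡ b mod m → a ^ n ≡ b ^ n mod m
  ^-cong-mod zero    _   = mod-refl
  ^-cong-mod (suc n) a≡b = *-cong-mod a≡b (^-cong-mod n a≡b)

  ∣⇒≡0-mod : ∀ {a} → + m ∣ a → a ≡ 0ℤ mod m
  ∣⇒≡0-mod {a} d = congruent (∣-subst (sym (ℤ.+-identityʳ a)) d)

  ≡0-mod⇒∣ : ∀ {a} → a ≡ 0ℤ mod m → + m ∣ a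
  ≡0-mod⇒∣ {a} (congruent d) = ∣-subst (ℤ.+-identityʳ a) d

mod-setoid : ℕ → Setoid _ _
mod-setoid m = record
  { Carrier = ℤ
  ; _≈_ = λ a b → a ≡ b mod m
  ; isEquivalence = record { refl = mod-refl ; sym = mod-sym ; trans = mod-trans }
  }

module mod-Reasoning (m : ℕ) where
  open import Relation.Binary.Reasoning.Setoid (mod-setoid m) public

%ℕ-mod : ∀ a m .{{_ : NonZero m}} → a ≡ + (a %ℕ m) mod m
%ℕ-mod a m = congruent (divides (a /ℕ m) (begin
  a - + (a %ℕ m)                         ≡⟨ cong (_- + (a %ℕ m)) (a≡a%ℕn+[a/ℕn]*n a m) ⟩
  + (a %ℕ m) + a /ℕ m * + m - + (a %ℕ m) ≡⟨ cancel (+ (a %ℕ m)) (a /ℕ m * + m) ⟩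
  a /ℕ m * + m                           ∎))
  where
  open ≡-Reasoning
  cancel : ∀ r s → r + s - r ≡ s
  cancel = solve-∀

∣∧<⇒≡0 : ∀ {m n} → m ℕ.∣ n → n ℕ.< m → n ≡ 0
∣∧<⇒≡0 {n = zero}  _   _   = refl
∣∧<⇒≡0 {n = suc _} m∣n n<m = ⊥-elim (ℕ.>⇒∤ n<m m∣n)

residue-injective : ∀ {m a b} → a ℕ.< m → b ℕ.< m → + a ≡ + b mod m → a ≡ b
residue-injective {m} {a} {b} a<m b<m (congruent m∣a-b) =
  ℤ.+-injective (ℤ.i-j≡0⇒i≡j (+ a) (+ b) (ℤ.∣i∣≡0⇒i≡0 ∣a-b∣≡0))
  where
  ∣a-b∣<m : abs (+ a - + b) ℕ.< m
  ∣a-b∣<m = ℕ.≤-<-trans (ℕ.≤-reflexive (cong abs (ℤ.m-n≡m⊖n a b)))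
              (ℕ.≤-<-trans (ℤ.∣m⊝n∣≤m⊔n a b) (ℕ.⊔-lub a<m b<m))
  ∣a-b∣≡0 : abs (+ a - + b) ≡ 0
  ∣a-b∣≡0 = ∣∧<⇒≡0 (∣⇒∣ᵤ m∣a-b) ∣a-b∣<m

∤⇒suc : ∀ {m n} → ¬ (m ℕ.∣ n) → ∃[ n′ ] n ≡ suc n′
∤⇒suc {n = zero}  m∤0 = ⊥-elim (m∤0 (_ ℕ.∣0))
∤⇒suc {n = suc n} _   = n , refl

∤-residue : ∀ {m k} → 0 ℕ.< k → k ℕ.< m → ¬ (+ m ∣ + k)
∤-residue {k = suc _} _ k<m m∣k = ℕ.>⇒∤ k<m (∣⇒∣ᵤ m∣k)

∣⇒[z/n]*n≡z : ∀ {n z} .{{_ : NonZero n}} → + n ∣ z → z ℤ./ + n * + n ≡ z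
∣⇒[z/n]*n≡z {n} {z} n∣z =
  sym (trans (a≡a%n+[a/n]*n z (+ n)) (trans (cong (λ r → + r + z ℤ./ + n * + n) z%n≡0) (ℤ.+-identityˡ _)))
  where
  z%n≡0 : z ℤ.% + n ≡ 0
  z%n≡0 = residue-injective (n%ℕd<d z n) (ℕ.>-nonZero⁻¹ n) (mod-trans (mod-sym (%ℕ-mod z n)) (∣⇒≡0-mod n∣z))

odd⇒≡1-mod-2 : ∀ {a} → ¬ (+ 2 ∣ a) → a ≡ 1ℤ mod 2
odd⇒≡1-mod-2 {a} 2∤a with a %ℕ 2 in a%2 | n%ℕd<d a 2
... | 0 | _ = ⊥-elim (2∤a (≡0-mod⇒∣ (subst (λ r → a ≡ + r mod 2) a%2 (%ℕ-mod a 2))))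
... | 1 | _ = subst (λ r → a ≡ + r mod 2) a%2 (%ℕ-mod a 2)
... | suc (suc _) | s≤s (s≤s ())

double-injective : ∀ {m n} → m ℕ.+ m ≡ n ℕ.+ n → m ≡ n
double-injective {m} {n} m+m≡n+n = ℕ.*-cancelˡ-≡ m n 2
  (trans (cong (m ℕ.+_) (ℕ.+-identityʳ m)) (trans m+m≡n+n (sym (cong (n ℕ.+_) (ℕ.+-identityʳ n)))))

odd⇒≡1+2n : ∀ {l} → ¬ (2 ℕ.∣ l) → l ≡ suc (l ℕ./ 2 ℕ.+ l ℕ./ 2)
odd⇒≡1+2n {l} 2∤l with l ℕ.% 2 in l%2 | ℕ.m%n<n l 2
... | 0           | _               = ⊥-elim (2∤l (ℕ.m%n≡0⇒n∣m l 2 l%2))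
... | 1           | _               = begin
  l                               ≡⟨ ℕ.m≡m%n+[m/n]*n l 2 ⟩
  l ℕ.% 2 ℕ.+ l ℕ./ 2 ℕ.* 2        ≡⟨ cong (ℕ._+ l ℕ./ 2 ℕ.* 2) l%2 ⟩
  suc (l ℕ./ 2 ℕ.* 2)             ≡⟨ cong suc (double (l ℕ./ 2)) ⟩
  suc (l ℕ./ 2 ℕ.+ l ℕ./ 2)       ∎
  where
  open ≡-Reasoning
  double : ∀ m → m ℕ.* 2 ≡ m ℕ.+ m
  double = ℕ-solve-∀
... | suc (suc _) | s≤s (s≤s ())

infix 4 _≡?_mod_
_≡?_mod_ : ∀ a b m → Dec (a ≡ b mod m)
a ≡? b mod m = map′ congruent m∣a-b (+ m ∣? (a - b))

IsSquareMod : ℕ → ℤ → Set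
IsSquareMod m a = ∃[ y ] y * y ≡ a mod m

IsSquareMod? : ∀ m .{{_ : NonZero m}} a → Dec (IsSquareMod m a)
IsSquareMod? m a with Fin.any? {n = m} (λ i → + toℕ i * + toℕ i ≡? a mod m)
... | yes (i , i²≡a) = yes (+ toℕ i , i²≡a)
... | no ¬residue    = no λ (y , y²≡a) → ¬residue (fromℕ< (n%ℕd<d y m) , residue² y y²≡a)
  where
  residue² : ∀ y → y * y ≡ a mod m → + toℕ (fromℕ< (n%ℕd<d y m)) * + toℕ (fromℕ< (n%ℕd<d y m)) ≡ a mod m
  residue² y y²≡a rewrite Fin.toℕ-fromℕ< (n%ℕd<d y m) =
    mod-trans (*-cong-mod (mod-sym (%ℕ-mod y m)) (mod-sym (%ℕ-mod y m))) y²≡a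

square-* : ∀ {m a b} → IsSquareMod m a → IsSquareMod m b → IsSquareMod m (a * b)
square-* (x , x²≡a) (y , y²≡b) = x * y , mod-trans (mod-reflexive (interchange x y)) (*-cong-mod x²≡a y²≡b)
  where
  interchange : ∀ x y → x * y * (x * y) ≡ x * x * (y * y)
  interchange = solve-∀

square-resp : ∀ {m a b} → a ≡ b mod m → IsSquareMod m a → IsSquareMod m b
square-resp a≡b (y , y²≡a) = y , mod-trans y²≡a a≡b

m≡-1-mod-1+m : ∀ m → + m ≡ -1ℤ mod suc m
m≡-1-mod-1+m m = congruent (divides 1ℤ (trans (cong +_ (ℕ.+-comm m 1)) (sym (ℤ.*-identityˡ _))))

-1≢1-mod : ∀ {m} → 3 ℕ.≤ m → ¬ (-1ℤ ≡ 1ℤ mod m)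
-1≢1-mod 3≤m (congruent m∣-2) = ℕ.<⇒≱ 3≤m (ℕ.∣⇒≤ (∣⇒∣ᵤ m∣-2))

∈⇒↭∷ : ∀ {A : Set} {x : A} {ys} → x ∈ ys → ∃[ zs ] ys ↭ x ∷ zs
∈⇒↭∷ {x = x} x∈ys with ys₁ , ys₂ , refl ← ∈-∃++ x∈ys = ys₁ ++ ys₂ , shift x ys₁ ys₂

∈-∷-≢ : ∀ {A : Set} {x y : A} {ys} → x ∈ y ∷ ys → x ≢ y → x ∈ ys
∈-∷-≢ (here x≡y)  x≢y = ⊥-elim (x≢y x≡y)
∈-∷-≢ (there x∈ys) _  = x∈ys

unique∧⊆∧length⇒↭ : ∀ {A : Set} {xs ys : List A} →
  Unique xs → xs ⊆ ys → length ys ℕ.≤ length xs → xs ↭ ys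
unique∧⊆∧length⇒↭ {xs = []} {[]} _ _ _ = ↭-refl
unique∧⊆∧length⇒↭ {xs = x ∷ xs} (x∉xs ∷ xs!) x∷xs⊆ys len with zs , ys↭x∷zs ← ∈⇒↭∷ (x∷xs⊆ys (here refl)) =
  ↭-trans (↭-prep x (unique∧⊆∧length⇒↭ xs! xs⊆zs len′)) (↭-sym ys↭x∷zs)
  where
  xs⊆zs : xs ⊆ zs
  xs⊆zs z∈xs = ∈-∷-≢ (∈-resp-↭ ys↭x∷zs (x∷xs⊆ys (there z∈xs))) (λ { refl → All.lookup x∉xs z∈xs refl })
  len′ : length zs ℕ.≤ length xs
  len′ = ℕ.s≤s⁻¹ (subst (ℕ._≤ suc (length xs)) (↭-length ys↭x∷zs) len)

∏ : List ℤ → ℤ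
∏ = foldr _*_ 1ℤ

∏-↭ : ∀ {xs ys} → xs ↭ ys → ∏ xs ≡ ∏ ys
∏-↭ xs↭ys = Permutationₛ.foldr-commMonoid *-1.setoid *-1.isCommutativeMonoid (↭⇒↭ₛ xs↭ys)
  where module *-1 = CommutativeMonoid ℤ.*-1-commutativeMonoid

∏-∷ʳ : ∀ xs y → ∏ (xs ∷ʳ y) ≡ ∏ xs * y
∏-∷ʳ xs y = trans (sym (∏-↭ (∷↭∷ʳ y xs))) (ℤ.*-comm y (∏ xs))

oneTo : ℕ → List ℕ
oneTo = applyUpTo suc

∈-oneTo⁻ : ∀ {k n} → k ∈ oneTo n → 1 ℕ.≤ k × k ℕ.≤ n
∈-oneTo⁻ k∈ with i , i<n , refl ← ∈-applyUpTo⁻ suc k∈ = s≤s z≤n , i<n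

∈-oneTo⁺ : ∀ {k n} → 1 ℕ.≤ k → k ℕ.≤ n → k ∈ oneTo n
∈-oneTo⁺ {suc k} _ k<n = ∈-applyUpTo⁺ suc k<n

module _ {A : Set} where

  sum-cong : ∀ {f g : A → ℕ} xs → (∀ {x} → x ∈ xs → f x ≡ g x) → sum (map f xs) ≡ sum (map g xs)
  sum-cong []       _   = refl
  sum-cong (x ∷ xs) f≡g = cong₂ ℕ._+_ (f≡g (here refl)) (sum-cong xs (f≡g ∘ there))

  sum-map-+ : ∀ (f g : A → ℕ) xs → sum (map (λ x → f x ℕ.+ g x) xs) ≡ sum (map f xs) ℕ.+ sum (map g xs)
  sum-map-+ f g []       = refl
  sum-map-+ f g (x ∷ xs) = trans (cong (f x ℕ.+ g x ℕ.+_) (sum-map-+ f g xs)) (interchange (f x) (g x) _ _)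
    where
    interchange : ∀ a b c d → a ℕ.+ b ℕ.+ (c ℕ.+ d) ≡ a ℕ.+ c ℕ.+ (b ℕ.+ d)
    interchange = ℕ-solve-∀

  sum-map-*ˡ : ∀ c (f : A → ℕ) xs → sum (map (λ x → c ℕ.* f x) xs) ≡ c ℕ.* sum (map f xs)
  sum-map-*ˡ c f []       = sym (ℕ.*-zeroʳ c)
  sum-map-*ˡ c f (x ∷ xs) = trans (cong (c ℕ.* f x ℕ.+_) (sum-map-*ˡ c f xs)) (sym (ℕ.*-distribˡ-+ c (f x) _))

  sum-map-const : ∀ c (xs : List A) → sum (map (λ _ → c) xs) ≡ length xs ℕ.* c
  sum-map-const c []       = refl
  sum-map-const c (x ∷ xs) = cong (c ℕ.+_) (sum-map-const c xs)

  ∏-cong-mod : ∀ {m} {f g : A → ℤ} xs → (∀ {x} → x ∈ xs → f x ≡ g x mod m) → ∏ (map f xs) ≡ ∏ (map g xs) mod m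
  ∏-cong-mod []       _   = mod-refl
  ∏-cong-mod (x ∷ xs) f≡g = *-cong-mod (f≡g (here refl)) (∏-cong-mod xs (f≡g ∘ there))

  ∏-map-* : ∀ (f g : A → ℤ) xs → ∏ (map (λ x → f x * g x) xs) ≡ ∏ (map f xs) * ∏ (map g xs)
  ∏-map-* f g []       = refl
  ∏-map-* f g (x ∷ xs) = trans (cong (f x * g x *_) (∏-map-* f g xs)) (interchange (f x) (g x) _ _)
    where
    interchange : ∀ a b c d → a * b * (c * d) ≡ a * c * (b * d)
    interchange = solve-∀

  ∏-map-^ : ∀ b (e : A → ℕ) xs → ∏ (map (λ x → b ^ e x) xs) ≡ b ^ sum (map e xs)
  ∏-map-^ b e []       = refl
  ∏-map-^ b e (x ∷ xs) = trans (cong (b ^ e x *_) (∏-map-^ b e xs)) (sym (ℤ.^-distribˡ-+-* b (e x) _))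

  ∏-map-const : ∀ c (xs : List A) → ∏ (map (λ _ → c) xs) ≡ c ^ length xs
  ∏-map-const c []       = refl
  ∏-map-const c (x ∷ xs) = cong (c *_) (∏-map-const c xs)

sum-swap : ∀ {A B : Set} (f : A → B → ℕ) xs ys →
           sum (map (λ x → sum (map (f x) ys)) xs) ≡ sum (map (λ y → sum (map (λ x → f x y) xs)) ys)
sum-swap f []       ys = sym (trans (sum-map-const 0 ys) (ℕ.*-zeroʳ (length ys)))
sum-swap f (x ∷ xs) ys = trans (cong (sum (map (f x) ys) ℕ.+_) (sum-swap f xs ys)) (sym (sum-map-+ (f x) _ ys))

Incongruent : ℕ → List ℤ → Set
Incongruent m = AllPairs (λ x y → ¬ (x ≡ y mod m))

incongruent-↭ : ∀ {m xs ys} → xs ↭ ys → Incongruent m xs → Incongruent m ys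
incongruent-↭ xs↭ys = AllPairs-resp-↭ (_∘ mod-sym) ((λ { refl x≢y → x≢y }) , (λ { refl x≢y → x≢y })) (↭⇒↭ₛ xs↭ys)

range : ℕ → ℕ → List ℤ
range s = applyUpTo (λ i → + (s ℕ.+ i))

module _ {m s n : ℕ} (s+n≤m : s ℕ.+ n ℕ.≤ m) where

  private
    s+i<m : ∀ {i} → i ℕ.< n → s ℕ.+ i ℕ.< m
    s+i<m i<n = ℕ.<-≤-trans (ℕ.+-monoʳ-< s i<n) s+n≤m

  range-incongruent : Incongruent m (range s n)
  range-incongruent = AllPairs.applyUpTo⁺₁ _ n λ i<j j<n si≡sj →
    ℕ.<⇒≢ (ℕ.+-monoʳ-< s i<j) (residue-injective (s+i<m (ℕ.<-trans i<j j<n)) (s+i<m j<n) si≡sj)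

  range-∤ : 0 ℕ.< s → All (λ x → ¬ (+ m ∣ x)) (range s n)
  range-∤ 0<s = All.applyUpTo⁺₁ _ n λ {i} i<n → ∤-residue (ℕ.<-≤-trans 0<s (ℕ.m≤m+n s i)) (s+i<m i<n)

PairedBy : ℕ → ℤ → List ℤ → Set
PairedBy m a xs = ∀ {x} → x ∈ xs → ∃[ y ] y ∈ xs × y ≢ x × x * y ≡ a mod m

-- Arithmetic modulo a prime

module _ {p : ℕ} (p-prime : Prime p) where

  private instance
    p≢0 : NonZero p
    p≢0 = prime⇒nonZero p-prime

  euclidsLemmaℤ : ∀ a b → + p ∣ a * b → + p ∣ a ⊎ + p ∣ b
  euclidsLemmaℤ a b p∣ab with euclidsLemma (abs a) (abs b) p-prime (subst (p ℕ.∣_) (ℤ.abs-* a b) (∣⇒∣ᵤ p∣ab))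
  ... | inj₁ p∣a = inj₁ (∣ᵤ⇒∣ p∣a)
  ... | inj₂ p∣b = inj₂ (∣ᵤ⇒∣ p∣b)

  prime∤* : ∀ {a b} → ¬ (+ p ∣ a) → ¬ (+ p ∣ b) → ¬ (+ p ∣ a * b)
  prime∤* {a} {b} p∤a p∤b p∣ab = [ p∤a , p∤b ]′ (euclidsLemmaℤ a b p∣ab)

  prime∤1 : ¬ (+ p ∣ 1ℤ)
  prime∤1 p∣1 = ¬prime[1] (subst Prime (ℕ.∣1⇒≡1 (∣⇒∣ᵤ p∣1)) p-prime)

  prime∣prime⇒≡ : ∀ {q} → Prime q → p ℕ.∣ q → p ≡ q
  prime∣prime⇒≡ q-prime p∣q with prime⇒irreducible q-prime p∣q
  ... | inj₁ refl = ⊥-elim (¬prime[1] p-prime)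
  ... | inj₂ p≡q  = p≡q

  *-cancelˡ-mod : ∀ {x a b} → ¬ (+ p ∣ x) → x * a ≡ x * b mod p → a ≡ b mod p
  *-cancelˡ-mod {x} {a} {b} p∤x (congruent p∣xa-xb) =
    [ (λ p∣x → ⊥-elim (p∤x p∣x)) , congruent ]′ (euclidsLemmaℤ x (a - b) (∣-subst (factor x a b) p∣xa-xb))
    where
    factor : ∀ x a b → x * a - x * b ≡ x * (a - b)
    factor = solve-∀

  inverse-of-residue : ∀ {r} → 0 ℕ.< r → r ℕ.< p → ∃[ u ] + r * u ≡ 1ℤ mod p
  inverse-of-residue {r@(suc _)} _ r<p with coprime-Bézout (coprime-sym (prime⇒coprime p-prime r<p))
  ... | Bézout.+- x y eq = + x , congruent (divides (+ y) (rearrange (+ r) (+ x) (+ y * + p) (lift eq)))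
    where
    lift : 1 ℕ.+ y ℕ.* p ≡ x ℕ.* r → 1ℤ + + y * + p ≡ + x * + r
    lift e = trans (cong (λ t → 1ℤ + t) (sym (ℤ.pos-* y p))) (trans (cong +_ e) (ℤ.pos-* x r))
    rearrange : ∀ r x s → 1ℤ + s ≡ x * r → r * x - 1ℤ ≡ s
    rearrange r x s e = trans (cong (_- 1ℤ) (trans (ℤ.*-comm r x) (sym e))) (cancel s)
      where
      cancel : ∀ s → 1ℤ + s - 1ℤ ≡ s
      cancel = solve-∀
  ... | Bézout.-+ x y eq = - + x , congruent (divides (- + y) (rearrange (+ r) (+ x) (+ y) (lift eq)))
    where
    lift : 1 ℕ.+ x ℕ.* r ≡ y ℕ.* p → 1ℤ + + x * + r ≡ + y * + p
    lift e = trans (cong (λ t → 1ℤ + t) (sym (ℤ.pos-* x r))) (trans (cong +_ e) (ℤ.pos-* y p))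
    rearrange : ∀ r x y → 1ℤ + x * r ≡ y * + p → r * - x - 1ℤ ≡ - y * + p
    rearrange r x y e = trans (negate r x) (trans (cong -_ e) (ℤ.neg-distribˡ-* y (+ p)))
      where
      negate : ∀ r x → r * - x - 1ℤ ≡ - (1ℤ + x * r)
      negate = solve-∀

  mod-inverse : ∀ {a} → ¬ (+ p ∣ a) → ∃[ u ] a * u ≡ 1ℤ mod p
  mod-inverse {a} p∤a with a %ℕ p in a%p | inverse-of-residue {a %ℕ p}
  ... | zero  | _   = ⊥-elim (p∤a (≡0-mod⇒∣ (subst (λ r → a ≡ + r mod p) a%p (%ℕ-mod a p))))
  ... | suc r | inv with inv (s≤s z≤n) (subst (ℕ._< p) a%p (n%ℕd<d a p))
  ...   | u , ru≡1 = u , mod-trans (*-cong-mod (subst (λ r → a ≡ + r mod p) a%p (%ℕ-mod a p)) mod-refl) ru≡1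

  mod-quotient : ∀ {k} → ¬ (+ p ∣ k) → ∀ a → ∃[ r ] r ℕ.< p × k * + r ≡ a mod p
  mod-quotient {k} p∤k a with u , ku≡1 ← mod-inverse p∤k = (a * u) %ℕ p , n%ℕd<d (a * u) p , (begin
    k * + ((a * u) %ℕ p) ≈⟨ *-cong-mod (mod-refl {a = k}) (mod-sym (%ℕ-mod (a * u) p)) ⟩
    k * (a * u)          ≡⟨ exchange k a u ⟩
    a * (k * u)          ≈⟨ *-cong-mod (mod-refl {a = a}) ku≡1 ⟩
    a * 1ℤ               ≡⟨ ℤ.*-identityʳ a ⟩
    a                    ∎)
    where
    open mod-Reasoning p
    exchange : ∀ k a u → k * (a * u) ≡ a * (k * u)
    exchange = solve-∀

  square≡1⇒≡±1 : ∀ x → x * x ≡ 1ℤ mod p → x ≡ 1ℤ mod p ⊎ x ≡ -1ℤ mod p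
  square≡1⇒≡±1 x (congruent p∣x²-1) with euclidsLemmaℤ (x - 1ℤ) (x + 1ℤ) (∣-subst (factor x) p∣x²-1)
    where
    factor : ∀ x → x * x - 1ℤ ≡ (x - 1ℤ) * (x + 1ℤ)
    factor = solve-∀
  ... | inj₁ p∣x-1 = inj₁ (congruent p∣x-1)
  ... | inj₂ p∣x+1 = inj₂ (congruent (∣-subst (sym (minus-minus x)) p∣x+1))
    where
    minus-minus : ∀ x → x - -1ℤ ≡ x + 1ℤ
    minus-minus = solve-∀

  *-cancelʳ-mod : ∀ {x a b} → ¬ (+ p ∣ x) → a * x ≡ b * x mod p → a ≡ b mod p
  *-cancelʳ-mod {x} {a} {b} p∤x ax≡bx =
    *-cancelˡ-mod p∤x (subst₂ (λ u v → u ≡ v mod p) (ℤ.*-comm a x) (ℤ.*-comm b x) ax≡bx)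

  -- remove an element and its partner: the partners of the remaining elements stay among them
  ∏-of-pairs : ∀ a xs → Incongruent p xs → All (λ x → ¬ (+ p ∣ x)) xs → PairedBy p a xs →
               ∃[ n ] (length xs ≡ n ℕ.+ n) × ∏ xs ≡ a ^ n mod p
  ∏-of-pairs a xs = go xs (<-wellFounded (length xs))
    where
    go : ∀ xs → Acc ℕ._<_ (length xs) → Incongruent p xs → All (λ x → ¬ (+ p ∣ x)) xs → PairedBy p a xs →
         ∃[ n ] (length xs ≡ n ℕ.+ n) × ∏ xs ≡ a ^ n mod p
    go [] _ _ _ _ = 0 , refl , mod-refl
    go (x ∷ tail) (acc rec) (x≇tail ∷ tail-incong) (p∤x ∷ p∤tail) paired
      with y , y∈x∷tail , y≢x , xy≡a ← paired (here refl)
      with zs , tail↭y∷zs ← ∈⇒↭∷ (∈-∷-≢ y∈x∷tail y≢x)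
      with y≇zs ∷ zs-incong ← incongruent-↭ tail↭y∷zs tail-incong
      with x≇y ∷ x≇zs ← All-resp-↭ tail↭y∷zs x≇tail
      with p∤y ∷ p∤zs ← All-resp-↭ tail↭y∷zs p∤tail
      = extend (go zs (rec length-zs<) zs-incong p∤zs zs-paired)
      where
      length-zs< : length zs ℕ.< length (x ∷ tail)
      length-zs< = subst (λ t → length zs ℕ.< suc t) (sym (↭-length tail↭y∷zs)) (ℕ.m<n⇒m<1+n (ℕ.n<1+n _))
      zs-paired : PairedBy p a zs
      zs-paired {z} z∈zs with w , w∈x∷tail , w≢z , zw≡a ← paired (there (∈-resp-↭ (↭-sym tail↭y∷zs) (there z∈zs))) =
        w , ∈-∷-≢ (∈-resp-↭ tail↭y∷zs (∈-∷-≢ w∈x∷tail w≢x)) w≢y , w≢z , zw≡a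
        where
        w≢x : w ≢ x
        w≢x refl = All.lookup y≇zs z∈zs
          (*-cancelˡ-mod p∤x (mod-trans xy≡a (mod-sym (subst (λ u → u ≡ a mod p) (ℤ.*-comm z x) zw≡a))))
        w≢y : w ≢ y
        w≢y refl = All.lookup x≇zs z∈zs (*-cancelʳ-mod p∤y (mod-trans xy≡a (mod-sym zw≡a)))
      extend : ∃[ n ] (length zs ≡ n ℕ.+ n) × ∏ zs ≡ a ^ n mod p →
               ∃[ n ] (length (x ∷ tail) ≡ n ℕ.+ n) × ∏ (x ∷ tail) ≡ a ^ n mod p
      extend (n , len-zs , ∏zs≡aⁿ) =
        suc n ,
        cong suc (trans (↭-length tail↭y∷zs) (trans (cong suc len-zs) (sym (ℕ.+-suc n n)))) ,
        mod-trans (mod-reflexive (trans (cong (x *_) (∏-↭ tail↭y∷zs)) (sym (ℤ.*-assoc x y (∏ zs)))))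
                  (*-cong-mod xy≡a ∏zs≡aⁿ)

  ∤-∏ : ∀ {A : Set} {f : A → ℤ} xs → (∀ {x} → x ∈ xs → ¬ (+ p ∣ f x)) → ¬ (+ p ∣ ∏ (map f xs))
  ∤-∏ []       _   = prime∤1
  ∤-∏ (x ∷ xs) p∤f = prime∤* (p∤f (here refl)) (∤-∏ xs (p∤f ∘ there))

  ∣foldl-*-elim : ∀ {R : Set} c xs → (+ p ∣ c → R) → All (λ x → + p ∣ x → R) xs → + p ∣ foldl _*_ c xs → R
  ∣foldl-*-elim c []       k []        p∣c = k p∣c
  ∣foldl-*-elim c (x ∷ xs) k (kx ∷ ks) p∣∏   =
    ∣foldl-*-elim (c * x) xs (λ p∣cx → [ k , kx ]′ (euclidsLemmaℤ c x p∣cx)) ks p∣∏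

  ∣^⇒∣ : ∀ x n → + p ∣ x ^ n → + p ∣ x
  ∣^⇒∣ x zero    p∣1     = ⊥-elim (prime∤1 p∣1)
  ∣^⇒∣ x (suc n) p∣x*xⁿ = [ (λ p∣x → p∣x) , ∣^⇒∣ x n ]′ (euclidsLemmaℤ x (x ^ n) p∣x*xⁿ)

no-prime-divisor⇒≡1 : ∀ n .{{_ : NonZero n}} → (∀ q → Prime q → ¬ (q ℕ.∣ n)) → n ≡ 1
no-prime-divisor⇒≡1 n no-divisor with factorise n
... | record { factors = []     ; isFactorisation = n≡1 } = n≡1
... | record { factors = q ∷ qs ; isFactorisation = n≡q*qs ; factorsPrime = q-prime ∷ _ } =
  ⊥-elim (no-divisor q q-prime (subst (q ℕ.∣_) (sym n≡q*qs) (ℕ.m∣m*n (product qs))))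

gcd≡1 : ∀ {a b} → b ≢ 0ℤ → (∀ q → Prime q → + q ∣ a → ¬ (+ q ∣ b)) → gcd a b ≡ 1ℤ
gcd≡1 {a} {b} b≢0 no-common = cong +_ (no-prime-divisor⇒≡1 (ℕ.gcd (abs a) (abs b)) {{g≢0}} λ q q-prime q∣g →
  no-common q q-prime (∣ᵤ⇒∣ (ℕ.∣-trans q∣g (gcd[i,j]∣i a b))) (∣ᵤ⇒∣ (ℕ.∣-trans q∣g (gcd[i,j]∣j a b))))
  where
  g≢0 : NonZero (ℕ.gcd (abs a) (abs b))
  g≢0 = ℕ.≢-nonZero (λ g≡0 → b≢0 (gcd[i,j]≡0⇒j≡0 {a} (cong +_ g≡0)))

gcd≡1⇒coprime : ∀ {a b q} → Prime q → gcd a b ≡ 1ℤ → + q ∣ a → ¬ (+ q ∣ b)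
gcd≡1⇒coprime {a} {b} {q} q-prime gcd≡1 q∣a q∣b =
  prime∤1 q-prime (∣ᵤ⇒∣ (subst (Unsigned._∣_ (+ q)) gcd≡1 (gcd-greatest {a} {b} {+ q} (∣⇒∣ᵤ q∣a) (∣⇒∣ᵤ q∣b))))

gcd≡1⇒∤ : ∀ {a q} → Prime q → gcd a (+ q) ≡ 1ℤ → ¬ (+ q ∣ a)
gcd≡1⇒∤ q-prime gcd≡1 q∣a = gcd≡1⇒coprime q-prime gcd≡1 q∣a ∣-refl

prime≢3⇒gcd≡1 : ∀ {q} → Prime q → q ≢ 3 → ℕ.gcd q 3 ≡ 1
prime≢3⇒gcd≡1 {q} q-prime q≢3 with prime⇒irreducible (from-yes (prime? 3)) (ℕ.gcd[m,n]∣n q 3)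
... | inj₁ gcd≡1 = gcd≡1
... | inj₂ gcd≡3 = ⊥-elim (q≢3 (sym (prime∣prime⇒≡ (from-yes (prime? 3)) q-prime (subst (ℕ._∣ q) gcd≡3 (ℕ.gcd[m,n]∣m q 3)))))

-- a primitive cube root of unity ζ would give (2ζ + 1)² ≡ -3
cube-root-of-unity≡1 : ∀ {p ζ} → Prime p → IsSquareMod p -1ℤ → ¬ IsSquareMod p (+ 3) → CubeRootOfUnity p ζ → ζ ≡ 1ℤ mod p
cube-root-of-unity≡1 {p} {ζ} p-prime (i , i²≡-1) 3-nonresidue p∣ζ³-1
  with euclidsLemmaℤ p-prime (ζ - 1ℤ) (ζ * ζ + ζ + 1ℤ) (∣-subst (factor ζ) (∣ᵤ⇒∣ p∣ζ³-1))
  where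
  factor : ∀ ζ → ζ * (ζ * (ζ * 1ℤ)) - 1ℤ ≡ (ζ - 1ℤ) * (ζ * ζ + ζ + 1ℤ)
  factor = solve-∀
... | inj₁ p∣ζ-1  = congruent p∣ζ-1
... | inj₂ p∣ζ²+ζ+1 = ⊥-elim (3-nonresidue (i * (+ 2 * ζ + 1ℤ) , mod-trans (mod-reflexive (expand i ζ))
        (*-cong-mod i²≡-1 (+-cong-mod (*-cong-mod (mod-refl {a = + 4}) (∣⇒≡0-mod p∣ζ²+ζ+1)) (mod-refl {a = - + 3})))))
  where
  expand : ∀ i ζ → i * (+ 2 * ζ + 1ℤ) * (i * (+ 2 * ζ + 1ℤ)) ≡ i * i * (+ 4 * (ζ * ζ + ζ + 1ℤ) - + 3)
  expand = solve-∀

-- Wilson's theorem and Euler's criterion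

-- 1 and p - 1 are the only self-inverse residues, so 2, ..., p - 2 split into pairs of inverses
inverse-pairs : ∀ {t} → Prime (3 ℕ.+ t) → PairedBy (3 ℕ.+ t) 1ℤ (range 2 t)
inverse-pairs {t} p-prime x∈ with i , i<t , refl ← ∈-applyUpTo⁻ _ x∈ =
  locate (mod-quotient p-prime (∤-residue (s≤s z≤n) k<p) 1ℤ)
  where
  p : ℕ
  p = 3 ℕ.+ t
  k : ℕ
  k = 2 ℕ.+ i
  k<p : k ℕ.< p
  k<p = s≤s (s≤s (s≤s (ℕ.<⇒≤ i<t)))
  k≢1 : ¬ (+ k ≡ 1ℤ mod p)
  k≢1 k≡1 = case residue-injective k<p (s≤s (s≤s z≤n)) k≡1 of λ ()
  k≢-1 : ¬ (+ k ≡ -1ℤ mod p)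
  k≢-1 k≡-1 = ℕ.<⇒≢ (s≤s (s≤s i<t)) (residue-injective k<p (ℕ.n<1+n _) (mod-trans k≡-1 (mod-sym (m≡-1-mod-1+m (2 ℕ.+ t)))))
  locate : ∃[ r ] r ℕ.< p × + k * + r ≡ 1ℤ mod p → ∃[ y ] y ∈ range 2 t × y ≢ + k × + k * y ≡ 1ℤ mod p
  locate (0 , _ , k0≡1) = ⊥-elim (prime∤1 p-prime (≡0-mod⇒∣ (mod-trans (mod-sym k0≡1) (mod-reflexive (ℤ.*-zeroʳ (+ k))))))
  locate (1 , _ , k1≡1) = ⊥-elim (k≢1 (subst (λ z → z ≡ 1ℤ mod p) (ℤ.*-identityʳ (+ k)) k1≡1))
  locate (suc (suc j) , r<p , kr≡1) with ℕ.m≤n⇒m<n∨m≡n (ℕ.s≤s⁻¹ (ℕ.s≤s⁻¹ (ℕ.s≤s⁻¹ r<p)))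
  ... | inj₁ j<t  = + (2 ℕ.+ j) , ∈-applyUpTo⁺ _ j<t , (λ { refl → [ k≢1 , k≢-1 ]′ (square≡1⇒≡±1 p-prime (+ k) kr≡1) }) , kr≡1
  ... | inj₂ refl = ⊥-elim (k≢-1 (subst (λ z → z ≡ -1ℤ mod p) (negate-negate (+ k))
                      (-‿cong-mod (mod-trans (*-cong-mod {a = + k} mod-refl (mod-sym (m≡-1-mod-1+m (2 ℕ.+ t)))) kr≡1))))
    where
    negate-negate : ∀ x → - (x * -1ℤ) ≡ x
    negate-negate = solve-∀

wilson : ∀ {p} → Prime p → ∏ (range 1 (p ℕ.∸ 1)) ≡ -1ℤ mod p
wilson {0} 0-prime = ⊥-elim (¬prime[0] 0-prime)
wilson {1} 1-prime = ⊥-elim (¬prime[1] 1-prime)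
wilson {2} _ = congruent (divides 1ℤ refl)
wilson {p@(suc (suc (suc t)))} p-prime = begin
  + 1 * ∏ (range 2 (suc t))          ≡⟨ cong (λ xs → + 1 * ∏ xs) (sym (List.applyUpTo-∷ʳ _ t)) ⟩
  + 1 * ∏ (range 2 t ∷ʳ + (2 ℕ.+ t)) ≡⟨ trans (ℤ.*-identityˡ _) (∏-∷ʳ (range 2 t) _) ⟩
  ∏ (range 2 t) * + (2 ℕ.+ t)        ≈⟨ *-cong-mod ∏-middle≡1 (m≡-1-mod-1+m (2 ℕ.+ t)) ⟩
  -1ℤ                                ∎
  where
  open mod-Reasoning p
  ∏-middle≡1 : ∏ (range 2 t) ≡ 1ℤ mod p
  ∏-middle≡1 with n , _ , ∏≡1ⁿ ← ∏-of-pairs p-prime 1ℤ (range 2 t) (range-incongruent (ℕ.n≤1+n _))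
                                   (range-∤ (ℕ.n≤1+n _) (s≤s z≤n)) (inverse-pairs p-prime) =
    mod-trans ∏≡1ⁿ (mod-reflexive (ℤ.^-zeroˡ n))

odd-prime-≥3 : ∀ {h} → Prime (suc (h ℕ.+ h)) → 3 ℕ.≤ suc (h ℕ.+ h)
odd-prime-≥3 {zero}   1-prime = ⊥-elim (¬prime[1] 1-prime)
odd-prime-≥3 {suc h} _        = s≤s (s≤s (ℕ.≤-trans (s≤s z≤n) (ℕ.m≤n+m (suc h) h)))

module _ {h : ℕ} (p-prime : Prime (suc (h ℕ.+ h))) where

  private
    p : ℕ
    p = suc (h ℕ.+ h)

  nonresidue-pairs : ∀ {a} → ¬ (+ p ∣ a) → ¬ IsSquareMod p a → PairedBy p a (range 1 (h ℕ.+ h))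
  nonresidue-pairs {a} p∤a a-nonresidue x∈units with i , i<p-1 , refl ← ∈-applyUpTo⁻ _ x∈units =
    locate (mod-quotient p-prime (∤-residue {p} (s≤s z≤n) (s≤s i<p-1)) a)
    where
    k : ℕ
    k = suc i
    locate : ∃[ r ] r ℕ.< p × + k * + r ≡ a mod p → ∃[ y ] y ∈ range 1 (h ℕ.+ h) × y ≢ + k × + k * y ≡ a mod p
    locate (zero , _ , k0≡a) = ⊥-elim (p∤a (≡0-mod⇒∣ (mod-trans (mod-sym k0≡a) (mod-reflexive (ℤ.*-zeroʳ (+ k))))))
    locate (suc j , r<p , kr≡a) = + suc j , ∈-applyUpTo⁺ _ (ℕ.s≤s⁻¹ r<p) , (λ { refl → a-nonresidue (+ k , kr≡a) }) , kr≡a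

  euler-nonresidue : ∀ {a} → ¬ (+ p ∣ a) → ¬ IsSquareMod p a → a ^ h ≡ -1ℤ mod p
  euler-nonresidue {a} p∤a a-nonresidue
    with n , n+n≡h+h , ∏≡aⁿ ← ∏-of-pairs p-prime a (range 1 (h ℕ.+ h))
           (range-incongruent ℕ.≤-refl) (range-∤ ℕ.≤-refl (s≤s z≤n)) (nonresidue-pairs p∤a a-nonresidue)
    = mod-trans (mod-sym (subst (λ e → _ ≡ a ^ e mod p) n≡h ∏≡aⁿ)) (wilson p-prime)
    where
    n≡h : n ≡ h
    n≡h = double-injective (trans (sym n+n≡h+h) (List.length-applyUpTo _ (h ℕ.+ h)))

  euler-criterion : ∀ {a} → ¬ (+ p ∣ a) → a ^ h ≡ 1ℤ mod p → IsSquareMod p a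
  euler-criterion {a} p∤a aʰ≡1 with IsSquareMod? p a
  ... | yes a-residue = a-residue
  ... | no a-nonresidue =
    ⊥-elim (-1≢1-mod (odd-prime-≥3 {h} p-prime) (mod-trans (mod-sym (euler-nonresidue p∤a a-nonresidue)) aʰ≡1))

-- Gauss's lemma

floor-sum : (p h a : ℕ) .{{_ : NonZero p}} → ℕ
floor-sum p h a = sum (map (λ k → k ℕ.* a ℕ./ p) (oneTo h))

-1^-even : ∀ x → -1ℤ ^ (x ℕ.+ x) ≡ 1ℤ
-1^-even zero    = refl
-1^-even (suc x) = trans (cong (λ e → -1ℤ * -1ℤ ^ e) (ℕ.+-suc x x)) (cong (λ e → -1ℤ * (-1ℤ * e)) (-1^-even x))

parity : ∀ {m n x y} → m ℕ.+ (x ℕ.+ x) ≡ n ℕ.+ (y ℕ.+ y) → -1ℤ ^ m ≡ -1ℤ ^ n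
parity {m} {n} {x} {y} e = trans (sym (drop-even m x)) (trans (cong (-1ℤ ^_) e) (drop-even n y))
  where
  drop-even : ∀ m x → -1ℤ ^ (m ℕ.+ (x ℕ.+ x)) ≡ -1ℤ ^ m
  drop-even m x = trans (ℤ.^-distribˡ-+-* -1ℤ m (x ℕ.+ x)) (trans (cong (-1ℤ ^ m *_) (-1^-even x)) (ℤ.*-identityʳ _))

^-distribʳ-* : ∀ x y n → (x * y) ^ n ≡ x ^ n * y ^ n
^-distribʳ-* x y zero    = refl
^-distribʳ-* x y (suc n) = trans (cong (x * y *_) (^-distribʳ-* x y n)) (interchange x y _ _)
  where
  interchange : ∀ a b c d → a * b * (c * d) ≡ a * c * (b * d)
  interchange = solve-∀

±-same-abs : ∀ {m x y s b c} → b ℕ.≤ 1 → c ℕ.≤ 1 → x ≡ -1ℤ ^ b * s mod m → y ≡ -1ℤ ^ c * s mod m →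
             x ≡ y mod m ⊎ x + y ≡ 0ℤ mod m
±-same-abs z≤n z≤n x≡s y≡s = inj₁ (mod-trans x≡s (mod-sym y≡s))
±-same-abs (s≤s z≤n) (s≤s z≤n) x≡s y≡s = inj₁ (mod-trans x≡s (mod-sym y≡s))
±-same-abs {s = s} z≤n (s≤s z≤n) x≡s y≡s = inj₂ (mod-trans (+-cong-mod x≡s y≡s) (mod-reflexive (cancel s)))
  where
  cancel : ∀ s → 1ℤ * s + -1ℤ * 1ℤ * s ≡ 0ℤ
  cancel = solve-∀
±-same-abs {s = s} (s≤s z≤n) z≤n x≡s y≡s = inj₂ (mod-trans (+-cong-mod x≡s y≡s) (mod-reflexive (cancel s)))
  where
  cancel : ∀ s → -1ℤ * 1ℤ * s + 1ℤ * s ≡ 0ℤ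
  cancel = solve-∀

module _ {h : ℕ} (p-prime : Prime (suc (h ℕ.+ h))) where

  private
    p : ℕ
    p = suc (h ℕ.+ h)
    instance
      p≢0 : NonZero p
      p≢0 = prime⇒nonZero p-prime

  -- r ≡ (-1) ^ over-half r * least-residue r with least-residue r ∈ [1, h] for 0 < r < p
  over-half : ℕ → ℕ
  over-half r with r ℕ.≤? h
  ... | yes _ = 0
  ... | no  _ = 1

  least-residue : ℕ → ℕ
  least-residue r with r ℕ.≤? h
  ... | yes _ = r
  ... | no  _ = p ℕ.∸ r

  over-half≤1 : ∀ r → over-half r ℕ.≤ 1
  over-half≤1 r with r ℕ.≤? h
  ... | yes _ = z≤n
  ... | no  _ = s≤s z≤n

  least-residue-bounds : ∀ {r} → 0 ℕ.< r → r ℕ.< p → 1 ℕ.≤ least-residue r × least-residue r ℕ.≤ h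
  least-residue-bounds {r} 0<r r<p with r ℕ.≤? h
  ... | yes r≤h = 0<r , r≤h
  ... | no  r≰h = ℕ.m<n⇒0<n∸m r<p ,
                  ℕ.≤-trans (ℕ.∸-monoʳ-≤ p (ℕ.≰⇒> r≰h)) (ℕ.≤-reflexive (ℕ.m+n∸m≡n h h))

  least-residue-identity : ∀ {r} → r ℕ.< p →
    r ℕ.+ 2 ℕ.* (over-half r ℕ.* least-residue r) ≡ least-residue r ℕ.+ over-half r ℕ.* p
  least-residue-identity {r} r<p with r ℕ.≤? h
  ... | yes _ = trans (ℕ.+-identityʳ r) (sym (ℕ.+-identityʳ r))
  ... | no  _ = trans (reflect r (p ℕ.∸ r)) (cong (λ t → p ℕ.∸ r ℕ.+ 1 ℕ.* t) (ℕ.m+[n∸m]≡n (ℕ.<⇒≤ r<p)))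
    where
    reflect : ∀ r s → r ℕ.+ 2 ℕ.* (1 ℕ.* s) ≡ s ℕ.+ 1 ℕ.* (r ℕ.+ s)
    reflect = ℕ-solve-∀

  least-residue-≡ : ∀ {r} → r ℕ.< p → + r ≡ -1ℤ ^ over-half r * + least-residue r mod p
  least-residue-≡ {r} r<p with r ℕ.≤? h
  ... | yes _ = mod-reflexive (sym (ℤ.*-identityˡ (+ r)))
  ... | no  _ = congruent (divides 1ℤ (begin
    + r - -1ℤ ^ 1 * + (p ℕ.∸ r) ≡⟨ negate (+ r) (+ (p ℕ.∸ r)) ⟩
    + r + + (p ℕ.∸ r)           ≡⟨ cong +_ (ℕ.m+[n∸m]≡n (ℕ.<⇒≤ r<p)) ⟩
    + p                         ≡⟨ ℤ.*-identityˡ (+ p) ⟨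
    1ℤ * + p                    ∎))
    where
    open ≡-Reasoning
    negate : ∀ r s → r - -1ℤ ^ 1 * s ≡ r + s
    negate = solve-∀

  module _ (a : ℕ) (p∤a : ¬ (p ℕ.∣ a)) where

    -- k a = q k · p + r with r ≡ (-1) ^ ε k · s k, and k ↦ s k permutes 1, ..., h
    private
      ε s q : ℕ → ℕ
      ε k = over-half (k ℕ.* a ℕ.% p)
      s k = least-residue (k ℕ.* a ℕ.% p)
      q k = k ℕ.* a ℕ./ p

      ka≡±s : ∀ k → + (k ℕ.* a) ≡ -1ℤ ^ ε k * + s k mod p
      ka≡±s k = mod-trans (%ℕ-mod (+ (k ℕ.* a)) p) (least-residue-≡ (ℕ.m%n<n (k ℕ.* a) p))

      k<p : ∀ {k} → k ∈ oneTo h → k ℕ.< p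
      k<p k∈ = s≤s (ℕ.≤-trans (proj₂ (∈-oneTo⁻ k∈)) (ℕ.m≤m+n h h))

      s-∈ : ∀ {k} → k ∈ oneTo h → s k ∈ oneTo h
      s-∈ {k} k∈ = uncurry ∈-oneTo⁺ (least-residue-bounds (ℕ.n≢0⇒n>0 ka%p≢0) (ℕ.m%n<n (k ℕ.* a) p))
        where
        ka%p≢0 : k ℕ.* a ℕ.% p ≢ 0
        ka%p≢0 ka%p≡0 = [ ∤-residue (proj₁ (∈-oneTo⁻ k∈)) (k<p k∈) ∘ ∣ᵤ⇒∣ , p∤a ]′
          (euclidsLemma k a p-prime (ℕ.m%n≡0⇒n∣m (k ℕ.* a) p ka%p≡0))

      s-injective : ∀ {j k} → j ∈ oneTo h → k ∈ oneTo h → s j ≡ s k → j ≡ k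
      s-injective {j} {k} j∈ k∈ sj≡sk
        with ±-same-abs {s = + s k} {b = ε j} {c = ε k} (over-half≤1 _) (over-half≤1 _)
               (subst (λ t → + (j ℕ.* a) ≡ -1ℤ ^ ε j * + t mod p) sj≡sk (ka≡±s j)) (ka≡±s k)
      ... | inj₁ ja≡ka = residue-injective (k<p j∈) (k<p k∈)
              (*-cancelˡ-mod p-prime {x = + a} (p∤a ∘ ∣⇒∣ᵤ) (subst₂ (λ u v → u ≡ v mod p) (commute j) (commute k) ja≡ka))
        where
        commute : ∀ k → + (k ℕ.* a) ≡ + a * + k
        commute k = trans (cong +_ (ℕ.*-comm k a)) (ℤ.pos-* a k)
      ... | inj₂ ja+ka≡0 = ⊥-elim ([ p∤a ∘ ∣⇒∣ᵤ , ∤-residue 0<j+k j+k<p ]′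
              (euclidsLemmaℤ p-prime (+ a) (+ (j ℕ.+ k)) (∣-subst (factor j k) (≡0-mod⇒∣ ja+ka≡0))))
        where
        factor : ∀ j k → + (j ℕ.* a) + + (k ℕ.* a) ≡ + a * + (j ℕ.+ k)
        factor j k = trans (cong +_ (trans (sym (ℕ.*-distribʳ-+ a j k)) (ℕ.*-comm (j ℕ.+ k) a))) (ℤ.pos-* a (j ℕ.+ k))
        0<j+k : 0 ℕ.< j ℕ.+ k
        0<j+k = ℕ.≤-trans (proj₁ (∈-oneTo⁻ j∈)) (ℕ.m≤m+n j k)
        j+k<p : j ℕ.+ k ℕ.< p
        j+k<p = s≤s (ℕ.+-mono-≤ (proj₂ (∈-oneTo⁻ j∈)) (proj₂ (∈-oneTo⁻ k∈)))

      s-↭ : map s (oneTo h) ↭ oneTo h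
      s-↭ = unique∧⊆∧length⇒↭
        (AllPairs.map⁺ (AllPairs.applyUpTo⁺₁ suc h λ i<j j<h si≡sj →
          ℕ.<⇒≢ i<j (ℕ.suc-injective (s-injective (∈-applyUpTo⁺ suc (ℕ.<-trans i<j j<h)) (∈-applyUpTo⁺ suc j<h) si≡sj))))
        (λ z∈ → let k , k∈ , z≡sk = ∈-map⁻ s z∈ in subst (_∈ oneTo h) (sym z≡sk) (s-∈ k∈))
        (ℕ.≤-reflexive (trans (List.length-applyUpTo suc h)
          (sym (trans (List.length-map s (oneTo h)) (List.length-applyUpTo suc h)))))

      N : ℤ
      N = ∏ (map +_ (oneTo h))

      N≢0 : ¬ (+ p ∣ N)
      N≢0 = ∤-∏ p-prime (oneTo h) (λ k∈ → ∤-residue (proj₁ (∈-oneTo⁻ k∈)) (k<p k∈))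

      ∏ka≡Naʰ : ∏ (map (λ k → + (k ℕ.* a)) (oneTo h)) ≡ N * (+ a) ^ h
      ∏ka≡Naʰ = begin
        ∏ (map (λ k → + (k ℕ.* a)) ks) ≡⟨ cong ∏ (List.map-cong (λ k → ℤ.pos-* k a) ks) ⟩
        ∏ (map (λ k → + k * + a) ks)    ≡⟨ ∏-map-* +_ (λ _ → + a) ks ⟩
        N * ∏ (map (λ _ → + a) ks)      ≡⟨ cong (N *_) (∏-map-const (+ a) ks) ⟩
        N * (+ a) ^ length ks             ≡⟨ cong (λ n → N * (+ a) ^ n) (List.length-applyUpTo suc h) ⟩
        N * (+ a) ^ h                     ∎
        where
        open ≡-Reasoning
        ks : List ℕ
        ks = oneTo h

      ∏s≡N : ∏ (map (λ k → + s k) (oneTo h)) ≡ N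
      ∏s≡N = trans (cong ∏ (List.map-∘ (oneTo h))) (∏-↭ (↭-map⁺ +_ s-↭))

      gauss-lemma : (+ a) ^ h ≡ -1ℤ ^ sum (map ε (oneTo h)) mod p
      gauss-lemma = *-cancelˡ-mod p-prime N≢0 (begin
        N * (+ a) ^ h                                              ≡⟨ ∏ka≡Naʰ ⟨
        ∏ (map (λ k → + (k ℕ.* a)) ks)                          ≈⟨ ∏-cong-mod ks (λ {k} _ → ka≡±s k) ⟩
        ∏ (map (λ k → -1ℤ ^ ε k * + s k) ks)                    ≡⟨ ∏-map-* _ _ ks ⟩
        ∏ (map (λ k → -1ℤ ^ ε k) ks) * ∏ (map (λ k → + s k) ks) ≡⟨ cong₂ _*_ (∏-map-^ -1ℤ ε ks) ∏s≡N ⟩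
        -1ℤ ^ sum (map ε ks) * N                                 ≡⟨ ℤ.*-comm _ N ⟩
        N * -1ℤ ^ sum (map ε ks)                                 ∎)
        where
        open mod-Reasoning p
        ks : List ℕ
        ks = oneTo h

      ka-identity : ∀ k → a ℕ.* k ℕ.+ 2 ℕ.* (ε k ℕ.* s k) ≡ s k ℕ.+ p ℕ.* (ε k ℕ.+ q k)
      ka-identity k = begin
        a ℕ.* k ℕ.+ 2 ℕ.* (ε k ℕ.* s k)
          ≡⟨ cong (ℕ._+ 2 ℕ.* (ε k ℕ.* s k)) (trans (ℕ.*-comm a k) (ℕ.m≡m%n+[m/n]*n (k ℕ.* a) p)) ⟩
        r ℕ.+ q k ℕ.* p ℕ.+ 2 ℕ.* (ε k ℕ.* s k)   ≡⟨ swap r (q k ℕ.* p) _ ⟩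
        r ℕ.+ 2 ℕ.* (ε k ℕ.* s k) ℕ.+ q k ℕ.* p   ≡⟨ cong (ℕ._+ q k ℕ.* p) (least-residue-identity (ℕ.m%n<n (k ℕ.* a) p)) ⟩
        s k ℕ.+ ε k ℕ.* p ℕ.+ q k ℕ.* p           ≡⟨ collect (s k) (ε k) (q k) p ⟩
        s k ℕ.+ p ℕ.* (ε k ℕ.+ q k)               ∎
        where
        open ≡-Reasoning
        r : ℕ
        r = k ℕ.* a ℕ.% p
        swap : ∀ x y z → x ℕ.+ y ℕ.+ z ≡ x ℕ.+ z ℕ.+ y
        swap = ℕ-solve-∀
        collect : ∀ s e q p → s ℕ.+ e ℕ.* p ℕ.+ q ℕ.* p ≡ s ℕ.+ p ℕ.* (e ℕ.+ q)
        collect = ℕ-solve-∀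

      T X μ : ℕ
      T = sum (oneTo h)
      X = sum (map (λ k → ε k ℕ.* s k) (oneTo h))
      μ = sum (map ε (oneTo h))

      summed-identity : a ℕ.* T ℕ.+ 2 ℕ.* X ≡ T ℕ.+ p ℕ.* (μ ℕ.+ floor-sum p h a)
      summed-identity = begin
        a ℕ.* T ℕ.+ 2 ℕ.* X
          ≡⟨ cong₂ ℕ._+_ (trans (cong (λ xs → a ℕ.* sum xs) (sym (List.map-id ks))) (sym (sum-map-*ˡ a (λ k → k) ks)))
                         (sym (sum-map-*ˡ 2 (λ k → ε k ℕ.* s k) ks)) ⟩
        sum (map (λ k → a ℕ.* k) ks) ℕ.+ sum (map (λ k → 2 ℕ.* (ε k ℕ.* s k)) ks)
          ≡⟨ sum-map-+ _ _ ks ⟨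
        sum (map (λ k → a ℕ.* k ℕ.+ 2 ℕ.* (ε k ℕ.* s k)) ks)
          ≡⟨ sum-cong ks (λ {k} _ → ka-identity k) ⟩
        sum (map (λ k → s k ℕ.+ p ℕ.* (ε k ℕ.+ q k)) ks)
          ≡⟨ sum-map-+ _ _ ks ⟩
        sum (map s ks) ℕ.+ sum (map (λ k → p ℕ.* (ε k ℕ.+ q k)) ks)
          ≡⟨ cong₂ ℕ._+_ (sum-↭ s-↭) (trans (sum-map-*ˡ p _ ks) (cong (p ℕ.*_) (sum-map-+ ε q ks))) ⟩
        T ℕ.+ p ℕ.* (μ ℕ.+ floor-sum p h a)
          ∎
        where
        open ≡-Reasoning
        ks : List ℕ
        ks = oneTo h

    gauss-eisenstein : (+ a) ^ h ≡ -1ℤ ^ (floor-sum p h a ℕ.+ (a ℕ.∸ 1) ℕ.* sum (oneTo h)) mod p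
    gauss-eisenstein with a′ , a≡1+a′ ← ∤⇒suc p∤a =
      mod-trans gauss-lemma (mod-reflexive (trans (parity {μ} {Q ℕ.+ a′ ℕ.* T} {Q ℕ.+ h ℕ.* M} {X} μ+even≡Q+a′T+even)
        (cong (λ b → -1ℤ ^ (Q ℕ.+ (b ℕ.∸ 1) ℕ.* T)) (sym a≡1+a′))))
      where
      Q M : ℕ
      Q = floor-sum p h a
      M = μ ℕ.+ Q
      -- the summed identity, read modulo 2 (p is odd)
      μ+even≡Q+a′T+even : μ ℕ.+ ((Q ℕ.+ h ℕ.* M) ℕ.+ (Q ℕ.+ h ℕ.* M)) ≡ (Q ℕ.+ a′ ℕ.* T) ℕ.+ (X ℕ.+ X)
      μ+even≡Q+a′T+even = ℕ.+-cancelˡ-≡ T _ _ (begin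
        T ℕ.+ (μ ℕ.+ ((Q ℕ.+ h ℕ.* M) ℕ.+ (Q ℕ.+ h ℕ.* M))) ≡⟨ expand T μ Q h ⟩
        T ℕ.+ p ℕ.* M ℕ.+ Q
          ≡⟨ cong (ℕ._+ Q) (subst (λ b → b ℕ.* T ℕ.+ 2 ℕ.* X ≡ T ℕ.+ p ℕ.* M) a≡1+a′ summed-identity) ⟨
        suc a′ ℕ.* T ℕ.+ 2 ℕ.* X ℕ.+ Q                      ≡⟨ regroup a′ T X Q ⟩
        T ℕ.+ ((Q ℕ.+ a′ ℕ.* T) ℕ.+ (X ℕ.+ X))              ∎)
        where
        open ≡-Reasoning
        expand : ∀ T μ Q h → T ℕ.+ (μ ℕ.+ ((Q ℕ.+ h ℕ.* (μ ℕ.+ Q)) ℕ.+ (Q ℕ.+ h ℕ.* (μ ℕ.+ Q))))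
                              ≡ T ℕ.+ suc (h ℕ.+ h) ℕ.* (μ ℕ.+ Q) ℕ.+ Q
        expand = ℕ-solve-∀
        regroup : ∀ a′ T X Q → suc a′ ℕ.* T ℕ.+ 2 ℕ.* X ℕ.+ Q ≡ T ℕ.+ ((Q ℕ.+ a′ ℕ.* T) ℕ.+ (X ℕ.+ X))
        regroup = ℕ-solve-∀

  euler-square : ∀ {a} → ¬ (+ p ∣ a) → IsSquareMod p a → a ^ h ≡ 1ℤ mod p
  euler-square {a} p∤a (y , y²≡a) = begin
    a ^ h             ≈⟨ ^-cong-mod h (mod-sym y²≡a) ⟩
    (y * y) ^ h       ≡⟨ ^-distribʳ-* y y h ⟩
    y ^ h * y ^ h     ≈⟨ *-cong-mod yʰ≡±1 yʰ≡±1 ⟩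
    -1ℤ ^ E * -1ℤ ^ E ≡⟨ trans (sym (ℤ.^-distribˡ-+-* -1ℤ E E)) (-1^-even E) ⟩
    1ℤ                ∎
    where
    open mod-Reasoning p
    r : ℕ
    r = y %ℕ p
    p∤r : ¬ (p ℕ.∣ r)
    p∤r p∣r = p∤a (≡0-mod⇒∣ (mod-trans (mod-sym y²≡a) (*-cong-mod y≡0 y≡0)))
      where
      y≡0 : y ≡ 0ℤ mod p
      y≡0 = mod-trans (%ℕ-mod y p) (∣⇒≡0-mod (∣ᵤ⇒∣ p∣r))
    E : ℕ
    E = floor-sum p h r ℕ.+ (r ℕ.∸ 1) ℕ.* sum (oneTo h)
    yʰ≡±1 : y ^ h ≡ -1ℤ ^ E mod p
    yʰ≡±1 = mod-trans (^-cong-mod h (%ℕ-mod y p)) (gauss-eisenstein r p∤r)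

-- Eisenstein's lattice-point count

χ< : ℕ → ℕ → ℕ
χ< x y with x ℕ.<? y
... | yes _ = 1
... | no  _ = 0

χ<-yes : ∀ {x y} → x ℕ.< y → χ< x y ≡ 1
χ<-yes {x} {y} x<y with x ℕ.<? y
... | yes _   = refl
... | no  x≮y = ⊥-elim (x≮y x<y)

χ<-no : ∀ {x y} → ¬ (x ℕ.< y) → χ< x y ≡ 0
χ<-no {x} {y} x≮y with x ℕ.<? y
... | yes x<y = ⊥-elim (x≮y x<y)
... | no  _   = refl

χ<-complement : ∀ {x y} → x ≢ y → χ< x y ℕ.+ χ< y x ≡ 1
χ<-complement {x} {y} x≢y with ℕ.<-cmp x y
... | tri< x<y _ y≮x = cong₂ ℕ._+_ (χ<-yes x<y) (χ<-no y≮x)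
... | tri≈ _ x≡y _   = ⊥-elim (x≢y x≡y)
... | tri> x≮y _ y<x = cong₂ ℕ._+_ (χ<-no x≮y) (χ<-yes y<x)

module _ (m : ℕ) .{{_ : NonZero m}} {N : ℕ} (m∤N : ¬ (m ℕ.∣ N)) where

  *<⇒≤/ : ∀ {j} → j ℕ.* m ℕ.< N → j ℕ.≤ N ℕ./ m
  *<⇒≤/ {j} jm<N = subst (ℕ._≤ N ℕ./ m) (ℕ.m*n/n≡m j m) (ℕ./-monoˡ-≤ m (ℕ.<⇒≤ jm<N))

  ≤/⇒*< : ∀ {j} → j ℕ.≤ N ℕ./ m → j ℕ.* m ℕ.< N
  ≤/⇒*< {j} j≤N/m = ℕ.≤∧≢⇒< (ℕ.≤-trans (ℕ.*-monoˡ-≤ m j≤N/m) (ℕ.m/n*n≤m N m)) (λ jm≡N → m∤N (ℕ.divides j (sym jm≡N)))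

  -- j ranges over 1, ..., g and j m < N exactly when j ≤ ⌊N / m⌋
  count-multiples-below : ∀ g → sum (map (λ j → χ< (j ℕ.* m) N) (oneTo g)) ≡ g ℕ.⊓ (N ℕ./ m)
  count-multiples-below zero    = refl
  count-multiples-below (suc g) = begin
    sum (map f (oneTo (suc g)))          ≡⟨ cong (λ xs → sum (map f xs)) (sym (List.applyUpTo-∷ʳ suc g)) ⟩
    sum (map f (oneTo g ∷ʳ suc g))       ≡⟨ cong sum (List.map-++ f (oneTo g) _) ⟩
    sum (map f (oneTo g) ∷ʳ f (suc g))   ≡⟨ sum-↭ (∷↭∷ʳ (f (suc g)) (map f (oneTo g))) ⟨
    f (suc g) ℕ.+ sum (map f (oneTo g))  ≡⟨ cong (f (suc g) ℕ.+_) (count-multiples-below g) ⟩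
    f (suc g) ℕ.+ g ℕ.⊓ (N ℕ./ m)          ≡⟨ step ⟩
    suc g ℕ.⊓ (N ℕ./ m)                    ∎
    where
    open ≡-Reasoning
    f : ℕ → ℕ
    f j = χ< (j ℕ.* m) N
    step : f (suc g) ℕ.+ g ℕ.⊓ (N ℕ./ m) ≡ suc g ℕ.⊓ (N ℕ./ m)
    step with suc g ℕ.≤? N ℕ./ m
    ... | yes g<N/m = trans (cong₂ ℕ._+_ (χ<-yes (≤/⇒*< g<N/m)) (ℕ.m≤n⇒m⊓n≡m (ℕ.<⇒≤ g<N/m))) (sym (ℕ.m≤n⇒m⊓n≡m g<N/m))
    ... | no  g≮N/m = trans (cong₂ ℕ._+_ (χ<-no (g≮N/m ∘ *<⇒≤/)) (ℕ.m≥n⇒m⊓n≡n (ℕ.s≤s⁻¹ (ℕ.≰⇒> g≮N/m))))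
                            (sym (ℕ.m≥n⇒m⊓n≡n (ℕ.<⇒≤ (ℕ.≰⇒> g≮N/m))))

-- ⌊k q / p⌋ counts the lattice points (j, k), 1 ≤ j ≤ g, with j p < k q
private
  module Column {h g : ℕ} (p-prime : Prime (suc (h ℕ.+ h))) (q-prime : Prime (suc (g ℕ.+ g)))
                (p≢q : suc (h ℕ.+ h) ≢ suc (g ℕ.+ g)) where

    p q : ℕ
    p = suc (h ℕ.+ h)
    q = suc (g ℕ.+ g)

    p∤kq : ∀ {k} → k ∈ oneTo h → ¬ (p ℕ.∣ k ℕ.* q)
    p∤kq k∈ p∣kq with euclidsLemma _ q p-prime p∣kq
    ... | inj₁ p∣k = ∤-residue (proj₁ (∈-oneTo⁻ k∈)) (s≤s (ℕ.≤-trans (proj₂ (∈-oneTo⁻ k∈)) (ℕ.m≤m+n h h))) (∣ᵤ⇒∣ p∣k)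
    ... | inj₂ p∣q = p≢q (prime∣prime⇒≡ p-prime q-prime p∣q)

    floor≡count : ∀ {k} → k ∈ oneTo h → k ℕ.* q ℕ./ p ≡ sum (map (λ j → χ< (j ℕ.* p) (k ℕ.* q)) (oneTo g))
    floor≡count {k} k∈ = sym (trans (count-multiples-below p (p∤kq k∈) g) (ℕ.m≥n⇒m⊓n≡n kq/p≤g))
      where
      kq<[1+g]p : k ℕ.* q ℕ.< suc g ℕ.* p
      kq<[1+g]p = ℕ.≤-<-trans (ℕ.*-monoˡ-≤ q (proj₂ (∈-oneTo⁻ k∈)))
                    (subst (h ℕ.* q ℕ.<_) (bound h g) (ℕ.m<m+n (h ℕ.* q) (s≤s z≤n)))
        where
        bound : ∀ h g → h ℕ.* suc (g ℕ.+ g) ℕ.+ suc (h ℕ.+ g) ≡ suc g ℕ.* suc (h ℕ.+ h)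
        bound = ℕ-solve-∀
      kq/p≤g : k ℕ.* q ℕ./ p ℕ.≤ g
      kq/p≤g = ℕ.s≤s⁻¹ (ℕ.m<n*o⇒m/o<n kq<[1+g]p)

    jp≢kq : ∀ {j k} → k ∈ oneTo h → j ℕ.* p ≢ k ℕ.* q
    jp≢kq {j} k∈ jp≡kq = p∤kq k∈ (ℕ.divides j (sym jp≡kq))

floor-sum-reciprocity : ∀ {h g} → Prime (suc (h ℕ.+ h)) → Prime (suc (g ℕ.+ g)) → suc (h ℕ.+ h) ≢ suc (g ℕ.+ g) →
  floor-sum (suc (h ℕ.+ h)) h (suc (g ℕ.+ g)) ℕ.+ floor-sum (suc (g ℕ.+ g)) g (suc (h ℕ.+ h)) ≡ h ℕ.* g
floor-sum-reciprocity {h} {g} p-prime q-prime p≢q = begin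
  sum (map (λ k → k ℕ.* q ℕ./ p) ks) ℕ.+ sum (map (λ j → j ℕ.* p ℕ./ q) js)
    ≡⟨ cong₂ ℕ._+_ (sum-cong ks C₁.floor≡count) (sum-cong js C₂.floor≡count) ⟩
  sum (map (λ k → sum (map (λ j → below j k) js)) ks) ℕ.+ sum (map (λ j → sum (map (λ k → above j k) ks)) js)
    ≡⟨ cong (sum (map (λ k → sum (map (λ j → below j k) js)) ks) ℕ.+_) (sum-swap (λ k j → above j k) ks js) ⟨
  sum (map (λ k → sum (map (λ j → below j k) js)) ks) ℕ.+ sum (map (λ k → sum (map (λ j → above j k) js)) ks)
    ≡⟨ sum-map-+ _ _ ks ⟨
  sum (map (λ k → sum (map (λ j → below j k) js) ℕ.+ sum (map (λ j → above j k) js)) ks)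
    ≡⟨ sum-cong ks (λ k∈ → trans (sym (sum-map-+ _ _ js)) (sum-cong js (λ {j} _ → χ<-complement (C₁.jp≢kq {j} k∈)))) ⟩
  sum (map (λ _ → sum (map (λ _ → 1) js)) ks)
    ≡⟨ trans (sum-map-const _ ks) (cong₂ ℕ._*_ (List.length-applyUpTo suc h) (trans (sum-map-const 1 js) (ℕ.*-identityʳ _))) ⟩
  h ℕ.* length js
    ≡⟨ cong (h ℕ.*_) (List.length-applyUpTo suc g) ⟩
  h ℕ.* g
    ∎
  where
  open ≡-Reasoning
  module C₁ = Column {h} {g} p-prime q-prime p≢q
  module C₂ = Column {g} {h} q-prime p-prime (p≢q ∘ sym)
  p q : ℕ
  p = suc (h ℕ.+ h)
  q = suc (g ℕ.+ g)
  ks js : List ℕ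
  ks = oneTo h
  js = oneTo g
  below above : ℕ → ℕ → ℕ
  below j k = χ< (j ℕ.* p) (k ℕ.* q)
  above j k = χ< (k ℕ.* q) (j ℕ.* p)

-- Quadratic reciprocity

-1^≡±1 : ∀ e → -1ℤ ^ e ≡ 1ℤ ⊎ -1ℤ ^ e ≡ -1ℤ
-1^≡±1 zero    = inj₁ refl
-1^≡±1 (suc e) = [ inj₂ ∘ cong (-1ℤ *_) , inj₁ ∘ cong (-1ℤ *_) ]′ (-1^≡±1 e)

-1^≡1-mod⇒≡1 : ∀ {m} → 3 ℕ.≤ m → ∀ e → -1ℤ ^ e ≡ 1ℤ mod m → -1ℤ ^ e ≡ 1ℤ
-1^≡1-mod⇒≡1 3≤m e ≡1-mod with -1^≡±1 e
... | inj₁ ≡1  = ≡1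
... | inj₂ ≡-1 = ⊥-elim (-1≢1-mod 3≤m (subst (λ x → x ≡ 1ℤ mod _) ≡-1 ≡1-mod))

eisenstein : ∀ {h} (p-prime : Prime (suc (h ℕ.+ h))) {b} → ¬ (suc (h ℕ.+ h) ℕ.∣ suc (b ℕ.+ b)) →
  (+ suc (b ℕ.+ b)) ^ h ≡ -1ℤ ^ floor-sum (suc (h ℕ.+ h)) h (suc (b ℕ.+ b)) mod suc (h ℕ.+ h)
eisenstein {h} p-prime {b} p∤a = mod-trans (gauss-eisenstein {h} p-prime (suc (b ℕ.+ b)) p∤a)
  (mod-reflexive (parity {Q ℕ.+ (b ℕ.+ b) ℕ.* T} {Q} {0} {b ℕ.* T} (even-part Q b T)))
  where
  T Q : ℕ
  T = sum (oneTo h)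
  Q = floor-sum (suc (h ℕ.+ h)) h (suc (b ℕ.+ b))
  even-part : ∀ Q b T → Q ℕ.+ (b ℕ.+ b) ℕ.* T ℕ.+ 0 ≡ Q ℕ.+ (b ℕ.* T ℕ.+ b ℕ.* T)
  even-part = ℕ-solve-∀

module _ {h g : ℕ} (p-prime : Prime (suc (h ℕ.+ h))) (q-prime : Prime (suc (g ℕ.+ g)))
         (p≢q : suc (h ℕ.+ h) ≢ suc (g ℕ.+ g)) (p≡1-mod-4 : 2 ℕ.∣ h) where

  private
    p q : ℕ
    p = suc (h ℕ.+ h)
    q = suc (g ℕ.+ g)
    p∤q : ¬ (+ p ∣ + q)
    p∤q p∣q = p≢q (prime∣prime⇒≡ p-prime q-prime (∣⇒∣ᵤ p∣q))
    q∤p : ¬ (+ q ∣ + p)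
    q∤p q∣p = p≢q (sym (prime∣prime⇒≡ q-prime p-prime (∣⇒∣ᵤ q∣p)))
    Qpq Qqp : ℕ
    Qpq = floor-sum p h q
    Qqp = floor-sum q g p
    -- the lattice count Qpq + Qqp = h g is even
    same-sign : -1ℤ ^ Qpq ≡ -1ℤ ^ Qqp
    same-sign = parity {Qpq} {Qqp} {Qqp} {m ℕ.* g} (begin
      Qpq ℕ.+ (Qqp ℕ.+ Qqp)   ≡⟨ ℕ.+-assoc Qpq Qqp Qqp ⟨
      Qpq ℕ.+ Qqp ℕ.+ Qqp     ≡⟨ cong (ℕ._+ Qqp) (floor-sum-reciprocity {h} {g} p-prime q-prime p≢q) ⟩
      h ℕ.* g ℕ.+ Qqp         ≡⟨ cong (λ h → h ℕ.* g ℕ.+ Qqp) h≡m*2 ⟩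
      m ℕ.* 2 ℕ.* g ℕ.+ Qqp   ≡⟨ rearrange m g Qqp ⟩
      Qqp ℕ.+ (m ℕ.* g ℕ.+ m ℕ.* g) ∎)
      where
      open ≡-Reasoning
      open ℕ._∣_ p≡1-mod-4 renaming (quotient to m; equality to h≡m*2)
      rearrange : ∀ m g Q → m ℕ.* 2 ℕ.* g ℕ.+ Q ≡ Q ℕ.+ (m ℕ.* g ℕ.+ m ℕ.* g)
      rearrange = ℕ-solve-∀

  reciprocity : IsSquareMod q (+ p) → IsSquareMod p (+ q)
  reciprocity p-residue = euler-criterion {h} p-prime p∤q (mod-trans (eisenstein {h} p-prime {g} (p∤q ∘ ∣ᵤ⇒∣))
    (mod-reflexive (trans same-sign (-1^≡1-mod⇒≡1 (odd-prime-≥3 {g} q-prime) Qqp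
      (mod-trans (mod-sym (eisenstein {g} q-prime {h} (q∤p ∘ ∣ᵤ⇒∣))) (euler-square {g} q-prime q∤p p-residue))))))

  reciprocity⁻¹ : IsSquareMod p (+ q) → IsSquareMod q (+ p)
  reciprocity⁻¹ q-residue = euler-criterion {g} q-prime q∤p (mod-trans (eisenstein {g} q-prime {h} (q∤p ∘ ∣ᵤ⇒∣))
    (mod-reflexive (trans (sym same-sign) (-1^≡1-mod⇒≡1 (odd-prime-≥3 {h} p-prime) Qpq
      (mod-trans (mod-sym (eisenstein {h} p-prime {g} (p∤q ∘ ∣ᵤ⇒∣))) (euler-square {h} p-prime p∤q q-residue))))))

-- Primes p ≡ 1 (mod 8) with p ≡ 2 (mod 3)

sum-oneTo : ∀ n → 2 ℕ.* sum (oneTo n) ≡ n ℕ.* suc n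
sum-oneTo zero    = refl
sum-oneTo (suc n) = begin
  2 ℕ.* sum (oneTo (suc n))              ≡⟨ cong (λ xs → 2 ℕ.* sum xs) (sym (List.applyUpTo-∷ʳ suc n)) ⟩
  2 ℕ.* sum (oneTo n ∷ʳ suc n)           ≡⟨ cong (2 ℕ.*_) (sum-↭ (∷↭∷ʳ (suc n) (oneTo n))) ⟨
  2 ℕ.* (suc n ℕ.+ sum (oneTo n))        ≡⟨ ℕ.*-distribˡ-+ 2 (suc n) _ ⟩
  2 ℕ.* suc n ℕ.+ 2 ℕ.* sum (oneTo n)    ≡⟨ cong (2 ℕ.* suc n ℕ.+_) (sum-oneTo n) ⟩
  2 ℕ.* suc n ℕ.+ n ℕ.* suc n            ≡⟨ ℕ.*-distribʳ-+ (suc n) 2 n ⟨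
  suc (suc n) ℕ.* suc n                  ≡⟨ ℕ.*-comm (suc (suc n)) (suc n) ⟩
  suc n ℕ.* suc (suc n)                  ∎
  where open ≡-Reasoning

module _ {t : ℕ} (p-prime : Prime (suc (t ℕ.* 4 ℕ.+ t ℕ.* 4))) where

  private
    h p : ℕ
    h = t ℕ.* 4
    p = suc (h ℕ.+ h)
    instance
      p≢0 : NonZero p
      p≢0 = prime⇒nonZero p-prime
    h≡2t+2t : h ≡ t ℕ.* 2 ℕ.+ t ℕ.* 2
    h≡2t+2t = double t
      where
      double : ∀ t → t ℕ.* 4 ≡ t ℕ.* 2 ℕ.+ t ℕ.* 2
      double = ℕ-solve-∀
    p≡1-mod-4 : 2 ℕ.∣ h
    p≡1-mod-4 = ℕ.divides (t ℕ.* 2) (double t)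
      where
      double : ∀ t → t ℕ.* 4 ≡ t ℕ.* 2 ℕ.* 2
      double = ℕ-solve-∀

  -1-residue : IsSquareMod p -1ℤ
  -1-residue = euler-criterion {h} p-prime (prime∤1 p-prime ∘ ∣-subst (ℤ.neg-involutive 1ℤ) ∘ ∣m⇒∣-m)
    (mod-reflexive (trans (cong (-1ℤ ^_) h≡2t+2t) (-1^-even (t ℕ.* 2))))

  2-residue : IsSquareMod p (+ 2)
  2-residue = euler-criterion {h} p-prime (∤-residue (s≤s z≤n) (odd-prime-≥3 {h} p-prime) ∘ ∣ᵤ⇒∣ ∘ ∣⇒∣ᵤ)
    (mod-trans (gauss-eisenstein {h} p-prime 2 (ℕ.<⇒≱ (odd-prime-≥3 {h} p-prime) ∘ ℕ.∣⇒≤))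
      (mod-reflexive (trans (cong (λ e → -1ℤ ^ (e ℕ.+ 1 ℕ.* T)) no-wrap)
        (trans (cong (-1ℤ ^_) T-even) (-1^-even (t ℕ.* suc h))))))
    where
    T : ℕ
    T = sum (oneTo h)
    -- 2 k < p for k ≤ h, so no ⌊2k / p⌋ contributes
    no-wrap : floor-sum p h 2 ≡ 0
    no-wrap = trans (sum-cong (oneTo h) (λ k∈ → ℕ.m<n⇒m/n≡0 (2k<p (proj₂ (∈-oneTo⁻ k∈)))))
                    (trans (sum-map-const 0 (oneTo h)) (ℕ.*-zeroʳ (length (oneTo h))))
      where
      2k<p : ∀ {k} → k ℕ.≤ h → k ℕ.* 2 ℕ.< p
      2k<p {k} k≤h =
        s≤s (subst (ℕ._≤ h ℕ.+ h) (sym (trans (ℕ.*-comm k 2) (cong (k ℕ.+_) (ℕ.+-identityʳ k)))) (ℕ.+-mono-≤ k≤h k≤h))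
    T-even : 0 ℕ.+ 1 ℕ.* T ≡ t ℕ.* suc h ℕ.+ t ℕ.* suc h
    T-even = ℕ.*-cancelˡ-≡ (0 ℕ.+ 1 ℕ.* T) (t ℕ.* suc h ℕ.+ t ℕ.* suc h) 2 (trans (cong (2 ℕ.*_) (ℕ.*-identityˡ T))
               (trans (sum-oneTo h) (quadruple t)))
      where
      quadruple : ∀ t → t ℕ.* 4 ℕ.* suc (t ℕ.* 4) ≡ 2 ℕ.* (t ℕ.* suc (t ℕ.* 4) ℕ.+ t ℕ.* suc (t ℕ.* 4))
      quadruple = ℕ-solve-∀

  odd-prime-residue : ∀ {g} → Prime (suc (g ℕ.+ g)) → suc (g ℕ.+ g) ≢ p →
                      IsSquareMod (suc (g ℕ.+ g)) (+ p) → IsSquareMod p (+ suc (g ℕ.+ g))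
  odd-prime-residue {g} q-prime q≢p = reciprocity {h} {g} p-prime q-prime (q≢p ∘ sym) p≡1-mod-4

  -- by reciprocity 3 would make p ≡ 2 a square modulo 3
  3-nonresidue : p ℕ.% 3 ≡ 2 → ¬ IsSquareMod p (+ 3)
  3-nonresidue p%3≡2 3-residue = from-no (IsSquareMod? 3 (+ 2))
    (square-resp p≡2-mod-3 (reciprocity⁻¹ {h} {1} p-prime (from-yes (prime? 3)) p≢3 p≡1-mod-4 3-residue))
    where
    p≡2-mod-3 : + p ≡ + 2 mod 3
    p≡2-mod-3 = subst (λ r → + p ≡ + r mod 3) p%3≡2 (%ℕ-mod (+ p) 3)
    p≢3 : p ≢ 3
    p≢3 p≡3 = case trans (sym p%3≡2) (cong (ℕ._% 3) p≡3) of λ ()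

record QuadraticCharacter (p : ℕ) : Set where
  field
    -1-is-square          : IsSquareMod p -1ℤ
    2-is-square           : IsSquareMod p (+ 2)
    3-is-not-square       : ¬ IsSquareMod p (+ 3)
    odd-prime-reciprocity : ∀ {q} → Prime q → ¬ (2 ℕ.∣ q) → q ≢ p → IsSquareMod q (+ p) → IsSquareMod p (+ q)

quadratic-character : ∀ {p} → Prime p → p ℕ.% 8 ≡ 1 → p ℕ.% 3 ≡ 2 → QuadraticCharacter p
quadratic-character {p} p-prime p%8≡1 p%3≡2 =
  subst QuadraticCharacter (sym p≡8t+1) (character (subst Prime p≡8t+1 p-prime) (subst (λ r → r ℕ.% 3 ≡ 2) p≡8t+1 p%3≡2))
  where
  t : ℕ
  t = p ℕ./ 8
  p≡8t+1 : p ≡ suc (t ℕ.* 4 ℕ.+ t ℕ.* 4)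
  p≡8t+1 = trans (ℕ.m≡m%n+[m/n]*n p 8) (trans (cong (ℕ._+ t ℕ.* 8) p%8≡1) (regroup t))
    where
    regroup : ∀ t → 1 ℕ.+ t ℕ.* 8 ≡ suc (t ℕ.* 4 ℕ.+ t ℕ.* 4)
    regroup = ℕ-solve-∀
  character : Prime (suc (t ℕ.* 4 ℕ.+ t ℕ.* 4)) → suc (t ℕ.* 4 ℕ.+ t ℕ.* 4) ℕ.% 3 ≡ 2 →
              QuadraticCharacter (suc (t ℕ.* 4 ℕ.+ t ℕ.* 4))
  character p-prime p%3≡2 = record
    { -1-is-square          = -1-residue {t} p-prime
    ; 2-is-square           = 2-residue {t} p-prime
    ; 3-is-not-square       = 3-nonresidue {t} p-prime p%3≡2
    ; odd-prime-reciprocity = λ {q} q-prime 2∤q → subst (λ r → Prime r → r ≢ _ → IsSquareMod r _ → IsSquareMod _ (+ r))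
                                (sym (odd⇒≡1+2n 2∤q)) (odd-prime-residue {t} p-prime {q ℕ./ 2}) q-prime
    }

%8≡1⇒2∤ : ∀ {p} → p ℕ.% 8 ≡ 1 → ¬ (+ 2 ∣ + p)
%8≡1⇒2∤ {p} p%8≡1 2∣p = case ℕ.∣1⇒≡1 (ℕ.∣m+n∣m⇒∣n 2∣[p/8]*8+1 (ℕ.∣n⇒∣m*n (p ℕ./ 8) (ℕ.divides 4 refl))) of λ ()
  where
  2∣[p/8]*8+1 : 2 ℕ.∣ p ℕ./ 8 ℕ.* 8 ℕ.+ 1
  2∣[p/8]*8+1 = subst (2 ℕ.∣_) (trans (ℕ.m≡m%n+[m/n]*n p 8) (trans (cong (ℕ._+ p ℕ./ 8 ℕ.* 8) p%8≡1) (ℕ.+-comm 1 _))) (∣⇒∣ᵤ 2∣p)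

%3≡2⇒3∤ : ∀ {p} → p ℕ.% 3 ≡ 2 → ¬ (+ 3 ∣ + p)
%3≡2⇒3∤ {p} p%3≡2 3∣p = case trans (sym p%3≡2) (ℕ.n∣m⇒m%n≡0 p 3 (∣⇒∣ᵤ 3∣p)) of λ ()

3∤⇒∤3 : ∀ {p} → Prime p → ¬ (+ 3 ∣ + p) → ¬ (+ p ∣ + 3)
3∤⇒∤3 p-prime 3∤p p∣3 = 3∤p (∣-subst (cong +_ (sym (prime∣prime⇒≡ p-prime (from-yes (prime? 3)) (∣⇒∣ᵤ p∣3)))) ∣-refl)

-- Squares assembled from prime factors

square-product : ∀ {m} ns → (∀ {q} → q ∈ ns → IsSquareMod m (+ q)) → IsSquareMod m (+ product ns)
square-product []       _  = 1ℤ , mod-refl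
square-product (n ∷ ns) sq = square-resp (mod-reflexive (sym (ℤ.pos-* n (product ns))))
  (square-* (sq (here refl)) (square-product ns (sq ∘ there)))

square-of-prime-factorsℕ : ∀ {m} n .{{_ : NonZero n}} → (∀ q → Prime q → q ℕ.∣ n → IsSquareMod m (+ q)) → IsSquareMod m (+ n)
square-of-prime-factorsℕ {m} n sq = subst (λ k → IsSquareMod m (+ k)) (sym isFactorisation)
  (square-product factors λ q∈ → sq _ (All.lookup factorsPrime q∈) (subst (_ ℕ.∣_) (sym isFactorisation) (∈⇒∣product q∈)))
  where open PrimeFactorisation (factorise n)

square-of-prime-factors : ∀ {m} → IsSquareMod m -1ℤ → ∀ x → x ≢ 0ℤ →
  (∀ q → Prime q → + q ∣ x → IsSquareMod m (+ q)) → IsSquareMod m x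
square-of-prime-factors {m} -1-residue x x≢0 sq = by-sign (ℤ.+∣i∣≡i⊎+∣i∣≡-i x)
  where
  ∣x∣-residue : IsSquareMod m (+ abs x)
  ∣x∣-residue = square-of-prime-factorsℕ (abs x) {{ℕ.≢-nonZero (x≢0 ∘ ℤ.∣i∣≡0⇒i≡0)}} (λ q q-prime q∣ → sq q q-prime (∣ᵤ⇒∣ q∣))
  by-sign : + abs x ≡ x ⊎ + abs x ≡ - x → IsSquareMod m x
  by-sign (inj₁ ∣x∣≡x)  = subst (IsSquareMod m) ∣x∣≡x ∣x∣-residue
  by-sign (inj₂ ∣x∣≡-x) =
    square-resp (mod-reflexive (trans (cong (-1ℤ *_) ∣x∣≡-x) (trans (ℤ.-1*i≡-i (- x)) (ℤ.neg-involutive x))))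
      (square-* -1-residue ∣x∣-residue)

IsSquareQl⇒IsSquareMod : ∀ {l p} → Prime l → Prime p → l ≢ p → IsSquareQl l (+ p) → IsSquareMod l (+ p)
IsSquareQl⇒IsSquareMod {l} l-prime p-prime l≢p (zero , u , p≡u , _ , square-mod-powers)
  with x , l∣x²-u ← square-mod-powers 1 =
  x , congruent (∣-subst (cong (λ t → x * x - t) (trans (sym (ℤ.*-identityˡ u)) (sym p≡u)))
                  (subst (_∣ x * x - u) (ℤ.*-identityʳ (+ l)) (∣ᵤ⇒∣ l∣x²-u)))
IsSquareQl⇒IsSquareMod {l} {p} l-prime p-prime l≢p (suc j , u , p≡l²ʲu , _ , _) =
  ⊥-elim (l≢p (prime∣prime⇒≡ l-prime p-prime (∣⇒∣ᵤ (∣-subst (sym p≡l²ʲu) (∣m⇒∣m*n u (∣m⇒∣m*n _ (∣-refl {+ l})))))))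

-- Valuations

abs-pos-^ : ∀ l k → abs ((+ l) ^ k) ≡ l ℕ.^ k
abs-pos-^ l zero    = refl
abs-pos-^ l (suc k) = trans (ℤ.abs-* (+ l) ((+ l) ^ k)) (cong (l ℕ.*_) (abs-pos-^ l k))

module _ {l : ℕ} (l-prime : Prime l) where

  private
    instance
      l≢0 : NonZero l
      l≢0 = prime⇒nonZero l-prime

    Valℕ : ℕ → ℕ → Set
    Valℕ m k = l ℕ.^ k ℕ.∣ m × ¬ (l ℕ.^ suc k ℕ.∣ m)

    Val⇒Valℕ : ∀ {x k} → Val l x k → Valℕ (abs x) k
    Val⇒Valℕ {x} {k} (l^k∣x , l^1+k∤x) =
      subst (ℕ._∣ abs x) (abs-pos-^ l k) l^k∣x , l^1+k∤x ∘ subst (ℕ._∣ abs x) (sym (abs-pos-^ l (suc k)))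

    Valℕ⇒Val : ∀ {x k} → Valℕ (abs x) k → Val l x k
    Valℕ⇒Val {x} {k} (l^k∣x , l^1+k∤x) =
      subst (ℕ._∣ abs x) (sym (abs-pos-^ l k)) l^k∣x , l^1+k∤x ∘ subst (ℕ._∣ abs x) (abs-pos-^ l (suc k))

    Valℕ-* : ∀ {m n a b} → Valℕ m a → Valℕ n b → Valℕ (m ℕ.* n) (a ℕ.+ b)
    Valℕ-* {a = a} {b} (ℕ.divides m′ refl , l^1+a∤m) (ℕ.divides n′ refl , l^1+b∤n) =
      ℕ.divides (m′ ℕ.* n′) mn≡m′n′l^[a+b] ,
      λ l^1+a+b∣mn → [ l∤m′ , l∤n′ ]′ (euclidsLemma m′ n′ l-prime
        (ℕ.*-cancelʳ-∣ (l ℕ.^ (a ℕ.+ b)) {{ℕ.m^n≢0 l (a ℕ.+ b)}}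
          (subst (l ℕ.^ suc (a ℕ.+ b) ℕ.∣_) mn≡m′n′l^[a+b] l^1+a+b∣mn)))
      where
      mn≡m′n′l^[a+b] : m′ ℕ.* l ℕ.^ a ℕ.* (n′ ℕ.* l ℕ.^ b) ≡ m′ ℕ.* n′ ℕ.* l ℕ.^ (a ℕ.+ b)
      mn≡m′n′l^[a+b] = trans (interchange m′ (l ℕ.^ a) n′ (l ℕ.^ b)) (cong (m′ ℕ.* n′ ℕ.*_) (sym (ℕ.^-distribˡ-+-* l a b)))
        where
        interchange : ∀ m x n y → m ℕ.* x ℕ.* (n ℕ.* y) ≡ m ℕ.* n ℕ.* (x ℕ.* y)
        interchange = ℕ-solve-∀
      l∤m′ : ¬ (l ℕ.∣ m′)
      l∤m′ l∣m′ = l^1+a∤m (ℕ.*-pres-∣ l∣m′ (ℕ.∣-refl {l ℕ.^ a}))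
      l∤n′ : ¬ (l ℕ.∣ n′)
      l∤n′ l∣n′ = l^1+b∤n (ℕ.*-pres-∣ l∣n′ (ℕ.∣-refl {l ℕ.^ b}))

    1<l : 1 ℕ.< l
    1<l = ℕ.nonTrivial⇒n>1 l {{prime⇒nonTrivial l-prime}}

    Valℕ-exists : ∀ m .{{_ : NonZero m}} → ∃[ k ] Valℕ m k
    Valℕ-exists m = go m (<-wellFounded m)
      where
      go : ∀ m .{{_ : NonZero m}} → Acc ℕ._<_ m → ∃[ k ] Valℕ m k
      go m (acc rec) with l ℕ.∣? m
      ... | no l∤m = 0 , ℕ.1∣ m , l∤m ∘ subst (ℕ._∣ m) (ℕ.*-identityʳ l)
      ... | yes (ℕ.divides m′ refl)
        with k , l^k∣m′ , l^1+k∤m′ ← go m′ {{ℕ.m*n≢0⇒m≢0 m′}} (rec (ℕ.m<m*n m′ l {{ℕ.m*n≢0⇒m≢0 m′}} 1<l)) =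
        suc k , subst (ℕ._∣ m′ ℕ.* l) (ℕ.*-comm (l ℕ.^ k) l) (ℕ.*-pres-∣ l^k∣m′ (ℕ.∣-refl {l})) ,
        l^1+k∤m′ ∘ ℕ.*-cancelʳ-∣ l ∘ subst (ℕ._∣ m′ ℕ.* l) (ℕ.*-comm l (l ℕ.^ suc k))

  Val-* : ∀ {x y a b} → Val l x a → Val l y b → Val l (x * y) (a ℕ.+ b)
  Val-* {x} {y} {a} {b} v w = Valℕ⇒Val {x * y} {a ℕ.+ b} (subst (λ m → Valℕ m (a ℕ.+ b)) (sym (ℤ.abs-* x y))
    (Valℕ-* {abs x} {abs y} {a} {b} (Val⇒Valℕ {x} {a} v) (Val⇒Valℕ {y} {b} w)))

  Val-foldl : ∀ c a xs ks → Val l c a → Pointwise (Val l) xs ks → Val l (foldl _*_ c xs) (foldl ℕ._+_ a ks)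
  Val-foldl c a []       []       v []       = v
  Val-foldl c a (x ∷ xs) (k ∷ ks) v (w ∷ ws) = Val-foldl (c * x) (a ℕ.+ k) xs ks (Val-* {c} {x} {a} {k} v w) ws

  Val-unit : ∀ {x} → ¬ (+ l ∣ x) → Val l x 0
  Val-unit {x} l∤x = Valℕ⇒Val {x} {0} (ℕ.1∣ abs x , l∤x ∘ ∣ᵤ⇒∣ ∘ subst (ℕ._∣ abs x) (ℕ.*-identityʳ l))

  Val-exists : ∀ {x} → x ≢ 0ℤ → ∃[ k ] Val l x k
  Val-exists {x} x≢0 with k , v ← Valℕ-exists (abs x) {{ℕ.≢-nonZero (x≢0 ∘ ℤ.∣i∣≡0⇒i≡0)}} = k , Valℕ⇒Val {x} {k} v

-- The septuple

OddPrimeCoprime3⇒∤2 : ∀ {l} → OddPrimeCoprime3 l → ¬ (+ l ∣ + 2)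
OddPrimeCoprime3⇒∤2 (l-prime , 2∤l , _) l∣2 with prime∣prime⇒≡ l-prime (from-yes (prime? 2)) (∣⇒∣ᵤ l∣2)
... | refl = 2∤l ℕ.∣-refl

OddPrimeCoprime3⇒∤3 : ∀ {l} → OddPrimeCoprime3 l → ¬ (+ l ∣ + 3)
OddPrimeCoprime3⇒∤3 (l-prime , _ , gcd[l,3]≡1) l∣3 with prime∣prime⇒≡ l-prime (from-yes (prime? 3)) (∣⇒∣ᵤ l∣3)
... | refl = case gcd[l,3]≡1 of λ ()

module Septuple (p : ℕ) (α β κ : ℤ) where

  private
    X Y A B C D E F G : ℤ
    X = + p * α * α
    Y = + 9 * β * β
    A = Aα p α β
    B = Bα p α β κ
    C = Cα p α β κ
    D = Dα p α β
    E = Eα α β κ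
    F = Fα α β κ
    G = Gα α β

  G≢0 : α ≢ 0ℤ → β ≢ 0ℤ → G ≢ 0ℤ
  G≢0 α≢0 β≢0 G≡0 with ℤ.i*j≡0⇒i≡0∨j≡0 (+ 3 * α) G≡0
  ... | inj₁ 3α≡0 = [ (λ ()) , α≢0 ]′ (ℤ.i*j≡0⇒i≡0∨j≡0 (+ 3) 3α≡0)
  ... | inj₂ β≡0  = β≢0 β≡0

  module _ (2∤p : ¬ (+ 2 ∣ + p)) (2∤α : ¬ (+ 2 ∣ α)) (2∤β : ¬ (+ 2 ∣ β)) where

    private
      X≡1 : X ≡ 1ℤ mod 2
      X≡1 = *-cong-mod (*-cong-mod (odd⇒≡1-mod-2 2∤p) (odd⇒≡1-mod-2 2∤α)) (odd⇒≡1-mod-2 2∤α)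
      Y≡9 : Y ≡ + 9 mod 2
      Y≡9 = *-cong-mod (*-cong-mod (mod-refl {a = + 9}) (odd⇒≡1-mod-2 2∤β)) (odd⇒≡1-mod-2 2∤β)

    A*2≡X-Y : A * + 2 ≡ X - Y
    A*2≡X-Y = ∣⇒[z/n]*n≡z (≡0-mod⇒∣ (mod-trans (+-cong-mod X≡1 (-‿cong-mod Y≡9)) (congruent (divides (- + 4) refl))))

    D*2≡X+Y : D * + 2 ≡ X + Y
    D*2≡X+Y = ∣⇒[z/n]*n≡z (≡0-mod⇒∣ (mod-trans (+-cong-mod X≡1 Y≡9) (congruent (divides (+ 5) refl))))

    on-Xp : α ≢ 0ℤ → β ≢ 0ℤ → OnXp p A B C D E F G
    on-Xp α≢0 β≢0 = (λ (_ , _ , _ , _ , _ , _ , G≡0) → G≢0 α≢0 β≢0 G≡0) , first , second , third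
      where
      open ≡-Reasoning
      first : B * B - C * C + + 2 * + p * E * F ≡ 0ℤ
      first = identity (+ p) α β κ
        where
        identity : ∀ P α β κ →
          (+ 9) * (P * α * α - (+ 9) * β * β) * κ * κ * ((+ 9) * (P * α * α - (+ 9) * β * β) * κ * κ)
          - (+ 9) * (P * α * α + (+ 9) * β * β) * κ * κ * ((+ 9) * (P * α * α + (+ 9) * β * β) * κ * κ)
          + + 2 * P * ((+ 81) * α * β * κ * κ * κ) * ((+ 18) * α * β * κ) ≡ 0ℤ
        identity = solve-∀
      second : + 2 * A * B - + 2 * C * D + + p * F * F ≡ 0ℤ
      second = begin
        + 2 * A * B - + 2 * C * D + + p * F * F       ≡⟨ double A D B C (+ p * F * F) ⟩
        A * + 2 * B - C * (D * + 2) + + p * F * F     ≡⟨ cong₂ (λ a d → a * B - C * d + + p * F * F) A*2≡X-Y D*2≡X+Y ⟩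
        (X - Y) * B - C * (X + Y) + + p * F * F       ≡⟨ identity (+ p) α β κ ⟩
        0ℤ                                            ∎
        where
        double : ∀ a d b c r → + 2 * a * b - + 2 * c * d + r ≡ a * + 2 * b - c * (d * + 2) + r
        double = solve-∀
        identity : ∀ P α β κ →
          (P * α * α - (+ 9) * β * β) * ((+ 9) * (P * α * α - (+ 9) * β * β) * κ * κ)
          - (+ 9) * (P * α * α + (+ 9) * β * β) * κ * κ * (P * α * α + (+ 9) * β * β)
          + P * ((+ 18) * α * β * κ) * ((+ 18) * α * β * κ) ≡ 0ℤ
        identity = solve-∀
      -- A and D are halves, so the denominators are cleared first
      third : A * A - D * D + + p * G * G ≡ 0ℤ
      third = [ (λ ()) , (λ eq → eq) ]′ (ℤ.i*j≡0⇒i≡0∨j≡0 (+ 4) (begin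
        + 4 * (A * A - D * D + + p * G * G)                              ≡⟨ quadruple A D (+ p * G * G) ⟩
        (A * + 2) * (A * + 2) - (D * + 2) * (D * + 2) + + 4 * (+ p * G * G)
          ≡⟨ cong₂ (λ a d → a * a - d * d + + 4 * (+ p * G * G)) A*2≡X-Y D*2≡X+Y ⟩
        (X - Y) * (X - Y) - (X + Y) * (X + Y) + + 4 * (+ p * G * G)      ≡⟨ identity (+ p) α β ⟩
        0ℤ                                                               ∎))
        where
        quadruple : ∀ a d r → + 4 * (a * a - d * d + r) ≡ (a * + 2) * (a * + 2) - (d * + 2) * (d * + 2) + + 4 * r
        quadruple = solve-∀
        identity : ∀ P α β →
          (P * α * α - (+ 9) * β * β) * (P * α * α - (+ 9) * β * β) - (P * α * α + (+ 9) * β * β) * (P * α * α + (+ 9) * β * β)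
          + + 4 * (P * ((+ 3) * α * β) * ((+ 3) * α * β)) ≡ 0ℤ
        identity = solve-∀

  SquareAtDivisorsOf : ℤ → Set
  SquareAtDivisorsOf x = ∀ l → OddPrimeCoprime3 l → + l Unsigned.∣ x → IsSquareQl l (+ p)

  private
    Divides-αβκ : ℕ → Set
    Divides-αβκ l = + l ∣ α ⊎ + l ∣ β ⊎ + l ∣ κ

  E-divisor : ∀ {l} → Prime l → ¬ (+ l ∣ + 3) → + l ∣ E → Divides-αβκ l
  E-divisor {l} l-prime l∤3 = ∣foldl-*-elim l-prime (+ 81) (α ∷ β ∷ κ ∷ κ ∷ κ ∷ [])
    (λ l∣3⁴ → ⊥-elim (l∤3 (∣^⇒∣ l-prime (+ 3) 4 l∣3⁴))) (inj₁ ∷ inj₂ ∘ inj₁ ∷ κ-case ∷ κ-case ∷ κ-case ∷ [])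
    where
    κ-case : + l ∣ κ → Divides-αβκ l
    κ-case = inj₂ ∘ inj₂

  W-divisor : ∀ {l} → Prime l → ¬ (+ l ∣ + 2) → ¬ (+ l ∣ + 3) → + l ∣ + 4374 * α * β * β * β * κ * κ * κ → Divides-αβκ l
  W-divisor {l} l-prime l∤2 l∤3 = ∣foldl-*-elim l-prime (+ 4374) (α ∷ β ∷ β ∷ β ∷ κ ∷ κ ∷ κ ∷ [])
    (λ l∣2·3⁷ → ⊥-elim ([ l∤2 , l∤3 ∘ ∣^⇒∣ l-prime (+ 3) 7 ]′ (euclidsLemmaℤ l-prime (+ 2) ((+ 3) ^ 7) l∣2·3⁷)))
    (inj₁ ∷ β-case ∷ β-case ∷ β-case ∷ κ-case ∷ κ-case ∷ κ-case ∷ [])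
    where
    β-case : + l ∣ β → Divides-αβκ l
    β-case = inj₂ ∘ inj₁
    κ-case : + l ∣ κ → Divides-αβκ l
    κ-case = inj₂ ∘ inj₂

  module _ (αβ-square : SquareAtDivisorsOf (α * β)) (κ-square : SquareAtDivisorsOf κ) where

    private
      square-at-αβκ : ∀ {l} → OddPrimeCoprime3 l → Divides-αβκ l → IsSquareQl l (+ p)
      square-at-αβκ l-ok (inj₁ l∣α)        = αβ-square _ l-ok (∣⇒∣ᵤ (∣m⇒∣m*n β l∣α))
      square-at-αβκ l-ok (inj₂ (inj₁ l∣β)) = αβ-square _ l-ok (∣⇒∣ᵤ (∣n⇒∣m*n α l∣β))
      square-at-αβκ l-ok (inj₂ (inj₂ l∣κ)) = κ-square _ l-ok (∣⇒∣ᵤ l∣κ)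

    square-at-divisors-of-E : SquareAtDivisorsOf E
    square-at-divisors-of-E l l-ok@(l-prime , _) l∣E =
      square-at-αβκ l-ok (E-divisor l-prime (OddPrimeCoprime3⇒∤3 l-ok) (∣ᵤ⇒∣ l∣E))

    square-at-common-divisors : ¬ (+ 2 ∣ + p) → ¬ (+ 2 ∣ α) → ¬ (+ 2 ∣ β) → ∀ l → OddPrimeCoprime3 l →
      + l Unsigned.∣ (D * E - C * F) → + l Unsigned.∣ (A * E - B * F) → IsSquareQl l (+ p)
    square-at-common-divisors 2∤p 2∤α 2∤β l l-ok@(l-prime , _) l∣DE-CF l∣AE-BF =
      square-at-αβκ l-ok (W-divisor l-prime (OddPrimeCoprime3⇒∤2 l-ok) (OddPrimeCoprime3⇒∤3 l-ok)
        (∣-subst (ℤ.neg-involutive _) (∣m⇒∣-m (∣-subst eliminate (∣m∣n⇒∣m-n l∣[DE-CF]*2 l∣[AE-BF]*2)))))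
      where
      open ≡-Reasoning
      l∣[DE-CF]*2 : + l ∣ (D * E - C * F) * + 2
      l∣[DE-CF]*2 = ∣m⇒∣m*n (+ 2) (∣ᵤ⇒∣ {+ l} {D * E - C * F} l∣DE-CF)
      l∣[AE-BF]*2 : + l ∣ (A * E - B * F) * + 2
      l∣[AE-BF]*2 = ∣m⇒∣m*n (+ 2) (∣ᵤ⇒∣ {+ l} {A * E - B * F} l∣AE-BF)
      eliminate : (D * E - C * F) * + 2 - (A * E - B * F) * + 2 ≡ - (+ 4374 * α * β * β * β * κ * κ * κ)
      eliminate = begin
        (D * E - C * F) * + 2 - (A * E - B * F) * + 2             ≡⟨ double A D E B C F ⟩
        D * + 2 * E - A * + 2 * E - + 2 * C * F + + 2 * B * F     ≡⟨ cong₂ (λ a d → d * E - a * E - + 2 * C * F + + 2 * B * F)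
                                                                            (A*2≡X-Y 2∤p 2∤α 2∤β) (D*2≡X+Y 2∤p 2∤α 2∤β) ⟩
        (X + Y) * E - (X - Y) * E - + 2 * C * F + + 2 * B * F     ≡⟨ identity (+ p) α β κ ⟩
        - (+ 4374 * α * β * β * β * κ * κ * κ)                    ∎
        where
        double : ∀ a d e b c f →
          (d * e - c * f) * + 2 - (a * e - b * f) * + 2 ≡ d * + 2 * e - a * + 2 * e - + 2 * c * f + + 2 * b * f
        double = solve-∀
        identity : ∀ P α β κ →
          (P * α * α + + 9 * β * β) * (+ 81 * α * β * κ * κ * κ) - (P * α * α - + 9 * β * β) * (+ 81 * α * β * κ * κ * κ)
          - + 2 * (+ 9 * (P * α * α + + 9 * β * β) * κ * κ) * (+ 18 * α * β * κ)
          + + 2 * (+ 9 * (P * α * α - + 9 * β * β) * κ * κ) * (+ 18 * α * β * κ)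
          ≡ - (+ 4374 * α * β * β * β * κ * κ * κ)
        identity = solve-∀

  module _ (p-prime : Prime p) (3∤p : ¬ (+ 3 ∣ + p)) (p∤α : ¬ (+ p ∣ α)) (p∤β : ¬ (+ p ∣ β)) where

    private
      p∤3 : ¬ (+ p ∣ + 3)
      p∤3 = 3∤⇒∤3 p-prime 3∤p

    p∤E : ¬ (+ p ∣ κ) → ¬ (+ p ∣ E)
    p∤E p∤κ = [ p∤α , [ p∤β , p∤κ ]′ ]′ ∘ E-divisor p-prime p∤3

    p∤G : ¬ (+ p ∣ G)
    p∤G = ∣foldl-*-elim p-prime (+ 3) (α ∷ β ∷ []) p∤3 (p∤α ∷ p∤β ∷ [])

  module _ (2∤p : ¬ (+ 2 ∣ + p)) (2∤α : ¬ (+ 2 ∣ α)) (2∤β : ¬ (+ 2 ∣ β)) (3∤p : ¬ (+ 3 ∣ + p))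
           (α⊥3 : gcd α (+ 3) ≡ 1ℤ) (α⊥p : gcd α (+ p) ≡ 1ℤ) (α⊥β : gcd α β ≡ 1ℤ) (β⊥p : gcd β (+ p) ≡ 1ℤ) where

    private
      no-common-prime : ∀ {q} → Prime q → + q ∣ A → + q ∣ D → ¬ (+ q ∣ G)
      no-common-prime {q} q-prime q∣A q∣D = ∣foldl-*-elim q-prime (+ 3) (α ∷ β ∷ []) q∤3 (q∤α ∷ q∤β ∷ [])
        where
        q∣X-Y : + q ∣ X - Y
        q∣X-Y = ∣-subst (A*2≡X-Y 2∤p 2∤α 2∤β) (∣m⇒∣m*n (+ 2) q∣A)
        q∣X+Y : + q ∣ X + Y
        q∣X+Y = ∣-subst (D*2≡X+Y 2∤p 2∤α 2∤β) (∣m⇒∣m*n (+ 2) q∣D)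
        q∣2pαα : + q ∣ + 2 * + p * α * α
        q∣2pαα = ∣-subst (sum-XY (+ p) α β) (∣m∣n⇒∣m+n q∣X+Y q∣X-Y)
          where
          sum-XY : ∀ P α β → (P * α * α + + 9 * β * β) + (P * α * α - + 9 * β * β) ≡ + 2 * P * α * α
          sum-XY = solve-∀
        q∣18ββ : + q ∣ + 18 * β * β
        q∣18ββ = ∣-subst (difference-XY (+ p) α β) (∣m∣n⇒∣m-n q∣X+Y q∣X-Y)
          where
          difference-XY : ∀ P α β → (P * α * α + + 9 * β * β) - (P * α * α - + 9 * β * β) ≡ + 18 * β * β
          difference-XY = solve-∀
        q≡ : ∀ {r} → Prime r → + q ∣ + r → q ≡ r
        q≡ r-prime q∣r = prime∣prime⇒≡ q-prime r-prime (∣⇒∣ᵤ q∣r)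
        q∣2⇒2∣ : ∀ {x} → + q ∣ + 2 → + q ∣ x → + 2 ∣ x
        q∣2⇒2∣ {x} q∣2 = subst (λ r → + r ∣ x) (q≡ (from-yes (prime? 2)) q∣2)
        q∤α : ¬ (+ q ∣ α)
        q∤α q∣α = ∣foldl-*-elim q-prime (+ 18) (β ∷ β ∷ [])
          (λ q∣2·3² → [ (λ q∣2 → 2∤α (q∣2⇒2∣ q∣2 q∣α)) , (λ q∣3² → gcd≡1⇒coprime q-prime α⊥3 q∣α (∣^⇒∣ q-prime (+ 3) 2 q∣3²)) ]′
            (euclidsLemmaℤ q-prime (+ 2) ((+ 3) ^ 2) q∣2·3²))
          (gcd≡1⇒coprime q-prime α⊥β q∣α ∷ gcd≡1⇒coprime q-prime α⊥β q∣α ∷ []) q∣18ββ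
        q∤β : ¬ (+ q ∣ β)
        q∤β q∣β = ∣foldl-*-elim q-prime (+ 2) (+ p ∷ α ∷ α ∷ []) (λ q∣2 → 2∤β (q∣2⇒2∣ q∣2 q∣β))
          (gcd≡1⇒coprime q-prime β⊥p q∣β ∷ α-case ∷ α-case ∷ []) q∣2pαα
          where
          α-case : ¬ (+ q ∣ α)
          α-case q∣α = gcd≡1⇒coprime q-prime α⊥β q∣α q∣β
        q∤3 : ¬ (+ q ∣ + 3)
        q∤3 q∣3 = ∣foldl-*-elim q-prime (+ 2) (+ p ∷ α ∷ α ∷ [])
          (λ q∣2 → case trans (sym (q≡ (from-yes (prime? 2)) q∣2)) (q≡ (from-yes (prime? 3)) q∣3) of λ ())
          ((λ q∣p → 3∤p (subst (λ r → + r ∣ + p) (q≡ (from-yes (prime? 3)) q∣3) q∣p)) ∷ α-case ∷ α-case ∷ []) q∣2pαα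
          where
          α-case : ¬ (+ q ∣ α)
          α-case q∣α = gcd≡1⇒coprime q-prime α⊥3 q∣α q∣3

    gcd-ADG≡1 : α ≢ 0ℤ → β ≢ 0ℤ → gcd (gcd A D) G ≡ 1ℤ
    gcd-ADG≡1 α≢0 β≢0 = gcd≡1 {gcd A D} {G} (G≢0 α≢0 β≢0) λ q q-prime q∣gcd[A,D] →
      no-common-prime q-prime (∣-trans q∣gcd[A,D] gcd[A,D]∣A) (∣-trans q∣gcd[A,D] gcd[A,D]∣D)
      where
      gcd[A,D]∣A : gcd A D ∣ A
      gcd[A,D]∣A = ∣ᵤ⇒∣ (gcd[i,j]∣i A D)
      gcd[A,D]∣D : gcd A D ∣ D
      gcd[A,D]∣D = ∣ᵤ⇒∣ (gcd[i,j]∣j A D)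

  private
    prime-3 : Prime 3
    prime-3 = from-yes (prime? 3)

  valuation-gap : ∀ {n k} → ¬ (+ 3 ∣ α) → β ≢ 0ℤ → Val 3 κ k → k ℕ.< 2 ℕ.* n ℕ.∸ 1 →
                  ∃[ e ] ∃[ g ] Val 3 E e × Val 3 G g × e ℕ.< g ℕ.+ 6 ℕ.* n
  valuation-gap {n} {k} 3∤α β≢0 v₃κ k<2n-1 with b , v₃β ← Val-exists prime-3 β≢0 =
    4 ℕ.+ 0 ℕ.+ b ℕ.+ k ℕ.+ k ℕ.+ k , 1 ℕ.+ 0 ℕ.+ b ,
    Val-foldl prime-3 (+ 81) 4 (α ∷ β ∷ κ ∷ κ ∷ κ ∷ []) (0 ∷ b ∷ k ∷ k ∷ k ∷ []) v₃81 (v₃α ∷ v₃β ∷ v₃κ ∷ v₃κ ∷ v₃κ ∷ []) ,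
    Val-foldl prime-3 (+ 3) 1 (α ∷ β ∷ []) (0 ∷ b ∷ []) v₃3 (v₃α ∷ v₃β ∷ []) ,
    ℕ.≤-trans (ℕ.≤-reflexive (split b k)) (ℕ.+-monoʳ-≤ (1 ℕ.+ 0 ℕ.+ b) 4+3k≤6n)
    where
    v₃81 : Val 3 (+ 81) 4
    v₃81 = ℕ.∣-refl , from-no (243 ℕ.∣? 81)
    v₃3 : Val 3 (+ 3) 1
    v₃3 = ℕ.∣-refl , from-no (9 ℕ.∣? 3)
    v₃α : Val 3 α 0
    v₃α = Val-unit prime-3 3∤α
    split : ∀ b k → suc (4 ℕ.+ 0 ℕ.+ b ℕ.+ k ℕ.+ k ℕ.+ k) ≡ 1 ℕ.+ 0 ℕ.+ b ℕ.+ (4 ℕ.+ 3 ℕ.* k)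
    split = ℕ-solve-∀
    2+k≤2n : ∀ m → k ℕ.< m ℕ.∸ 1 → 2 ℕ.+ k ℕ.≤ m
    2+k≤2n (suc m) k<m = s≤s k<m
    4+3k≤6n : 4 ℕ.+ 3 ℕ.* k ℕ.≤ 6 ℕ.* n
    4+3k≤6n = ℕ.≤-trans (subst (4 ℕ.+ 3 ℕ.* k ℕ.≤_) (six k) (ℕ.m≤m+n (4 ℕ.+ 3 ℕ.* k) 2))
                (subst (3 ℕ.* (2 ℕ.+ k) ℕ.≤_) (sym (ℕ.*-assoc 3 2 n)) (ℕ.*-monoʳ-≤ 3 (2+k≤2n (2 ℕ.* n) k<2n-1)))
      where
      six : ∀ k → 4 ℕ.+ 3 ℕ.* k ℕ.+ 2 ≡ 3 ℕ.* (2 ℕ.+ k)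
      six = ℕ-solve-∀

  3∣G : + 3 ∣ G
  3∣G = ∣m⇒∣m*n β (∣m⇒∣m*n α ∣-refl)

  3∤A+B : ¬ (+ 2 ∣ + p) → ¬ (+ 2 ∣ α) → ¬ (+ 2 ∣ β) → ¬ (+ 3 ∣ + p) → ¬ (+ 3 ∣ α) → ¬ (+ 3 ∣ A + B)
  3∤A+B 2∤p 2∤α 2∤β 3∤p 3∤α 3∣A+B = ∣foldl-*-elim prime-3 (+ p) (α ∷ α ∷ []) 3∤p (3∤α ∷ 3∤α ∷ []) 3∣X
    where
    3∣9 : + 3 ∣ + 9
    3∣9 = divides (+ 3) refl
    3∣B : + 3 ∣ B
    3∣B = ∣m⇒∣m*n κ (∣m⇒∣m*n κ (∣m⇒∣m*n (X - Y) 3∣9))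
    3∣A : + 3 ∣ A
    3∣A = ∣m+n∣n⇒∣m 3∣A+B 3∣B
    3∣X-Y : + 3 ∣ X - Y
    3∣X-Y = ∣-subst (A*2≡X-Y 2∤p 2∤α 2∤β) (∣m⇒∣m*n (+ 2) 3∣A)
    3∣X : + 3 ∣ X
    3∣X = ∣-subst (cancel X Y) (∣m∣n⇒∣m+n 3∣X-Y (∣m⇒∣m*n β (∣m⇒∣m*n β 3∣9)))
      where
      cancel : ∀ X Y → X - Y + Y ≡ X
      cancel = solve-∀

  3κ-square : ∀ {k} → Prime p → QuadraticCharacter p → κ ≢ 0ℤ → ¬ (+ p ∣ κ) → SquareAtDivisorsOf κ →
              Val 3 κ k → ¬ (2 ℕ.∣ k) → IsSquareMod p (+ 3 * κ)
  3κ-square {k} p-prime χ κ≢0 p∤κ κ-square (3ᵏ∣κ , 3ᵏ⁺¹∤κ) 2∤k with divides κ′ κ≡κ′3ᵏ ← ∣ᵤ⇒∣ {(+ 3) ^ k} {κ} 3ᵏ∣κ =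
    square-resp (mod-reflexive (sym 3κ≡[3ʲ]²κ′)) (square-* ((+ 3) ^ j , mod-refl) κ′-square)
    where
    open QuadraticCharacter χ
    j : ℕ
    j = suc (k ℕ./ 2)
    3κ≡[3ʲ]²κ′ : + 3 * κ ≡ (+ 3) ^ j * (+ 3) ^ j * κ′
    3κ≡[3ʲ]²κ′ = begin
      + 3 * κ                       ≡⟨ cong (+ 3 *_) κ≡κ′3ᵏ ⟩
      + 3 * (κ′ * (+ 3) ^ k)        ≡⟨ rotate κ′ ((+ 3) ^ k) ⟩
      (+ 3) ^ suc k * κ′            ≡⟨ cong (λ e → (+ 3) ^ e * κ′) 1+k≡j+j ⟩
      (+ 3) ^ (j ℕ.+ j) * κ′        ≡⟨ cong (_* κ′) (ℤ.^-distribˡ-+-* (+ 3) j j) ⟩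
      (+ 3) ^ j * (+ 3) ^ j * κ′    ∎
      where
      open ≡-Reasoning
      rotate : ∀ a t → + 3 * (a * t) ≡ + 3 * t * a
      rotate = solve-∀
      1+k≡j+j : suc k ≡ j ℕ.+ j
      1+k≡j+j = trans (cong suc (odd⇒≡1+2n 2∤k)) (cong suc (sym (ℕ.+-suc (k ℕ./ 2) (k ℕ./ 2))))
    3∤κ′ : ¬ (+ 3 ∣ κ′)
    3∤κ′ (divides c κ′≡c·3) = 3ᵏ⁺¹∤κ (∣⇒∣ᵤ {(+ 3) ^ suc k} {κ}
      (divides c (trans κ≡κ′3ᵏ (trans (cong (_* (+ 3) ^ k) κ′≡c·3) (ℤ.*-assoc c (+ 3) ((+ 3) ^ k))))))
    κ′≢0 : κ′ ≢ 0ℤ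
    κ′≢0 κ′≡0 = κ≢0 (trans κ≡κ′3ᵏ (trans (cong (_* (+ 3) ^ k) κ′≡0) (ℤ.*-zeroˡ ((+ 3) ^ k))))
    prime-factor-square : ∀ q → Prime q → + q ∣ κ′ → IsSquareMod p (+ q)
    prime-factor-square q q-prime q∣κ′ with q ℕ.≟ 2 | q ℕ.≟ 3
    ... | yes refl | _        = 2-is-square
    ... | no _     | yes refl = ⊥-elim (3∤κ′ q∣κ′)
    ... | no q≢2   | no q≢3   = odd-prime-reciprocity q-prime 2∤q q≢p
      (IsSquareQl⇒IsSquareMod q-prime p-prime q≢p (κ-square q (q-prime , 2∤q , prime≢3⇒gcd≡1 q-prime q≢3) (∣⇒∣ᵤ q∣κ)))
      where
      q∣κ : + q ∣ κ
      q∣κ = ∣-subst (sym κ≡κ′3ᵏ) (∣m⇒∣m*n ((+ 3) ^ k) q∣κ′)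
      2∤q : ¬ (2 ℕ.∣ q)
      2∤q = q≢2 ∘ sym ∘ prime∣prime⇒≡ (from-yes (prime? 2)) q-prime
      q≢p : q ≢ p
      q≢p refl = p∤κ q∣κ
    κ′-square : IsSquareMod p κ′
    κ′-square = square-of-prime-factors -1-is-square κ′ κ′≢0 prime-factor-square

  module _ (p-prime : Prime p) (χ : QuadraticCharacter p) (2∤p : ¬ (+ 2 ∣ + p)) (2∤α : ¬ (+ 2 ∣ α)) (2∤β : ¬ (+ 2 ∣ β))
           (p∤3 : ¬ (+ p ∣ + 3)) (p∤β : ¬ (+ p ∣ β)) (p∤κ : ¬ (+ p ∣ κ)) (3κ-sq : IsSquareMod p (+ 3 * κ)) where

    open QuadraticCharacter χ

    private
      w : ℤ
      w = proj₁ 3κ-sq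
      w²≡3κ : w * w ≡ + 3 * κ mod p
      w²≡3κ = proj₂ 3κ-sq
      p∤w : ¬ (+ p ∣ w)
      p∤w p∣w = prime∤* p-prime p∤3 p∤κ (≡0-mod⇒∣ (mod-trans (mod-sym w²≡3κ)
        (mod-trans (*-cong-mod (∣⇒≡0-mod p∣w) (mod-refl {a = w})) (mod-reflexive (ℤ.*-zeroˡ w)))))
      H : ℤ
      H = proj₁ (mod-inverse p-prime p∤w)
      wH≡1 : w * H ≡ 1ℤ mod p
      wH≡1 = proj₂ (mod-inverse p-prime p∤w)
      -- v³ = 27 κ³ H⁶, so E H⁶ = G v³
      v : ℤ
      v = + 3 * κ * (H * H)
      v≡1 : v ≡ 1ℤ mod p
      v≡1 = mod-trans (*-cong-mod (mod-sym w²≡3κ) (mod-refl {a = H * H}))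
              (mod-trans (mod-reflexive (interchange w H)) (*-cong-mod wH≡1 wH≡1))
        where
        interchange : ∀ w H → w * w * (H * H) ≡ w * H * (w * H)
        interchange = solve-∀

    p∣G-EH⁶ : + p ∣ G - E * H ^ 6
    p∣G-EH⁶ = ∣-subst (sym (factor α β κ H)) (∣n⇒∣m*n G (≡0-mod⇒∣
      (+-cong-mod (mod-refl {a = 1ℤ}) (-‿cong-mod (*-cong-mod (*-cong-mod v≡1 v≡1) v≡1)))))
      where
      factor : ∀ α β κ H → + 3 * α * β - + 81 * α * β * κ * κ * κ * (H * (H * (H * (H * (H * (H * 1ℤ))))))
                           ≡ + 3 * α * β * (1ℤ - + 3 * κ * (H * H) * (+ 3 * κ * (H * H)) * (+ 3 * κ * (H * H)))
      factor = solve-∀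

    module _ {ζ : ℤ} (ζ³≡1 : CubeRootOfUnity p ζ) where

      private
        N : ℤ
        N = A + ζ * B * H ^ 4
        X≡0 : X ≡ 0ℤ mod p
        X≡0 = ∣⇒≡0-mod (∣m⇒∣m*n α (∣m⇒∣m*n α ∣-refl))

      2N≡-27β² : N * + 2 ≡ - (+ 27 * β * β) mod p
      2N≡-27β² = begin
        N * + 2
          ≡⟨ expand A ζ (+ p) α β κ H ⟩
        A * + 2 + ζ * (X - Y) * (v * v) * + 2
          ≡⟨ cong (λ a → a + ζ * (X - Y) * (v * v) * + 2) (A*2≡X-Y 2∤p 2∤α 2∤β) ⟩
        (X - Y) + ζ * (X - Y) * (v * v) * + 2
          ≈⟨ +-cong-mod X-Y≡-Y (*-cong-mod (*-cong-mod (*-cong-mod ζ≡1 X-Y≡-Y) (*-cong-mod v≡1 v≡1)) mod-refl) ⟩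
        (0ℤ - Y) + 1ℤ * (0ℤ - Y) * (1ℤ * 1ℤ) * + 2
          ≡⟨ collect β ⟩
        - (+ 27 * β * β)
          ∎
        where
        open mod-Reasoning p
        expand : ∀ a ζ P α β κ H →
          (a + ζ * (+ 9 * (P * α * α - + 9 * β * β) * κ * κ) * (H * (H * (H * (H * 1ℤ))))) * + 2
          ≡ a * + 2 + ζ * (P * α * α - + 9 * β * β) * (+ 3 * κ * (H * H) * (+ 3 * κ * (H * H))) * + 2
        expand = solve-∀
        ζ≡1 : ζ ≡ 1ℤ mod p
        ζ≡1 = cube-root-of-unity≡1 p-prime -1-is-square 3-is-not-square ζ³≡1
        X-Y≡-Y : X - Y ≡ 0ℤ - Y mod p
        X-Y≡-Y = +-cong-mod X≡0 mod-refl
        collect : ∀ β → (0ℤ - + 9 * β * β) + 1ℤ * (0ℤ - + 9 * β * β) * (1ℤ * 1ℤ) * + 2 ≡ - (+ 27 * β * β)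
        collect = solve-∀

      p∤N : ¬ (+ p ∣ N)
      p∤N p∣N = ∣foldl-*-elim p-prime (+ 27) (β ∷ β ∷ []) (p∤3 ∘ ∣^⇒∣ p-prime (+ 3) 3) (p∤β ∷ p∤β ∷ [])
        (∣-subst (ℤ.neg-involutive _) (∣m⇒∣-m (≡0-mod⇒∣ (mod-trans (mod-sym 2N≡-27β²) (∣⇒≡0-mod (∣m⇒∣m*n (+ 2) p∣N))))))

      -- with s² = 2, i² = -1 and c = (3β)⁻¹, a square root of N would give one of 3
      N-nonsquare : ¬ IsSquareMod p N
      N-nonsquare (y , y²≡N) = 3-is-not-square (s * y * i * c , (begin
        s * y * i * c * (s * y * i * c)              ≡⟨ regroup s y i c ⟩
        s * s * (y * y) * (i * i) * (c * c)          ≈⟨ *-cong-mod (*-cong-mod (*-cong-mod s²≡2 y²≡N) i²≡-1) mod-refl ⟩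
        + 2 * N * -1ℤ * (c * c)                      ≡⟨ negate N c ⟩
        - (N * + 2) * (c * c)                        ≈⟨ *-cong-mod (-‿cong-mod 2N≡-27β²) mod-refl ⟩
        - - (+ 27 * β * β) * (c * c)                 ≡⟨ regroup′ β c ⟩
        + 3 * (+ 3 * β * c * (+ 3 * β * c))          ≈⟨ *-cong-mod (mod-refl {a = + 3}) (*-cong-mod 3βc≡1 3βc≡1) ⟩
        + 3                                          ∎))
        where
        open mod-Reasoning p
        s : ℤ
        s = proj₁ 2-is-square
        s²≡2 : s * s ≡ + 2 mod p
        s²≡2 = proj₂ 2-is-square
        i : ℤ
        i = proj₁ -1-is-square
        i²≡-1 : i * i ≡ -1ℤ mod p
        i²≡-1 = proj₂ -1-is-square
        c : ℤ
        c = proj₁ (mod-inverse p-prime (prime∤* p-prime p∤3 p∤β))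
        3βc≡1 : + 3 * β * c ≡ 1ℤ mod p
        3βc≡1 = proj₂ (mod-inverse p-prime (prime∤* p-prime p∤3 p∤β))
        regroup : ∀ s y i c → s * y * i * c * (s * y * i * c) ≡ s * s * (y * y) * (i * i) * (c * c)
        regroup = solve-∀
        negate : ∀ N c → + 2 * N * -1ℤ * (c * c) ≡ - (N * + 2) * (c * c)
        negate = solve-∀
        regroup′ : ∀ β c → - - (+ 27 * β * β) * (c * c) ≡ + 3 * (+ 3 * β * c * (+ 3 * β * c))
        regroup′ = solve-∀

    H-witness : ∃[ H ] (+ p Unsigned.∣ G - E * H ^ 6) × (∀ ζ → CubeRootOfUnity p ζ → QNR p (A + ζ * B * H ^ 4))
    H-witness = H , ∣⇒∣ᵤ p∣G-EH⁶ , λ ζ ζ³≡1 →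
      p∤N {ζ} ζ³≡1 ∘ ∣ᵤ⇒∣ , λ (y , p∣y²-N) → N-nonsquare {ζ} ζ³≡1 (y , congruent (∣ᵤ⇒∣ p∣y²-N))

lemma3p1 : (p n : ℕ) (α β κ : ℤ) →
  Prime p → p ℕ.% 8 ≡ 1 → p ℕ.% 3 ≡ 2 → 2 ℕ.≤ n →
  α ≢ 0ℤ → β ≢ 0ℤ → κ ≢ 0ℤ →
  -- (B1)
  ¬ ((+ 2) Unsigned.∣ α) → ¬ ((+ 2) Unsigned.∣ β) →
  gcd α (+ 3) ≡ 1ℤ → gcd α (+ p) ≡ 1ℤ → gcd α β ≡ 1ℤ → gcd β (+ p) ≡ 1ℤ →
  -- (B2)
  (∀ (l : ℕ) → OddPrimeCoprime3 l → (+ l) Unsigned.∣ (α * β) → IsSquareQl l (+ p)) →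
  -- (B3)
  (∃[ k ] Val 3 κ k × k ℕ.< 2 ℕ.* n ℕ.∸ 1 × ¬ (2 ℕ.∣ k) × 0 ℕ.< k) →
  -- (B4)
  ¬ ((+ p) Unsigned.∣ κ) →
  -- (B5)
  (∀ (l : ℕ) → OddPrimeCoprime3 l → (+ l) Unsigned.∣ κ → IsSquareQl l (+ p)) →
  HypothesisFM p n (Aα p α β) (Bα p α β κ) (Cα p α β κ) (Dα p α β)
    (Eα α β κ) (Fα α β κ) (Gα α β)
lemma3p1 p n α β κ p-prime p%8≡1 p%3≡2 _ α≢0 β≢0 κ≢0 2∤α 2∤β α⊥3 α⊥p α⊥β β⊥p αβ-square
         (k , v₃κ , k<2n-1 , 2∤k , _) p∤κ κ-square = record
  { A1 = on-Xp 2∤p 2∤α′ 2∤β′ α≢0 β≢0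
  ; A2 = λ l l-ok _ l∣E → inj₁ (square-at-divisors-of-E αβ-square κ-square l l-ok l∣E)
  ; A3 = gcd-ADG≡1 2∤p 2∤α′ 2∤β′ 3∤p α⊥3 α⊥p α⊥β β⊥p α≢0 β≢0 ,
         p∤E p-prime 3∤p p∤α p∤β (p∤κ ∘ ∣⇒∣ᵤ) ∘ ∣ᵤ⇒∣ , p∤G p-prime 3∤p p∤α p∤β ∘ ∣ᵤ⇒∣
  ; A4 = λ l l-ok _ _ → square-at-common-divisors αβ-square κ-square 2∤p 2∤α′ 2∤β′ l l-ok
  ; A5 = H-witness p-prime χ 2∤p 2∤α′ 2∤β′ (3∤⇒∤3 p-prime 3∤p) p∤β (p∤κ ∘ ∣⇒∣ᵤ)
           (3κ-square p-prime χ κ≢0 (p∤κ ∘ ∣⇒∣ᵤ) κ-square v₃κ 2∤k)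
  ; A6 = λ _ → valuation-gap {n} (gcd≡1⇒∤ (from-yes (prime? 3)) α⊥3) β≢0 v₃κ k<2n-1
  ; A7 = λ _ → 3∤A+B 2∤p 2∤α′ 2∤β′ 3∤p (gcd≡1⇒∤ (from-yes (prime? 3)) α⊥3) ∘ ∣ᵤ⇒∣ , ∣⇒∣ᵤ 3∣G
  }
  where
  open Septuple p α β κ
  χ : QuadraticCharacter p
  χ = quadratic-character p-prime p%8≡1 p%3≡2
  2∤p : ¬ (+ 2 ∣ + p)
  2∤p = %8≡1⇒2∤ p%8≡1
  3∤p : ¬ (+ 3 ∣ + p)
  3∤p = %3≡2⇒3∤ p%3≡2
  2∤α′ : ¬ (+ 2 ∣ α)
  2∤α′ = 2∤α ∘ ∣⇒∣ᵤ
  2∤β′ : ¬ (+ 2 ∣ β)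
  2∤β′ = 2∤β ∘ ∣⇒∣ᵤ
  p∤α : ¬ (+ p ∣ α)
  p∤α = gcd≡1⇒∤ p-prime α⊥p
  p∤β : ¬ (+ p ∣ β)
  p∤β = gcd≡1⇒∤ p-prime β⊥p
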